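{- Let $P=([n],\preceq)$ be a poset, $w$ a weight on $\mathbb{F}_q$, and let the label map satisfy $k_i=k$ for all $i\in[n]$, so $N=nk$. Then for any $1\le r\le nM_w$, the number of $x\in\mathbb{F}_q^N$ with $w_{(P,w,\pi)}(x)=r$ is $$|A_r|=\sum_{i=1}^n\sum_{j=1}^i\ \sum_{I\in\mathcal{I}_j^i}\ \sum_{\substack{b\in PRT_{i-j}[r]\\ b\text{ has } j\text{ parts}}} q^{k(i-j)}\prod_{s=1}^l|D_{t_s}^k|^{r_s}\binom{j-(r_1+\cdots+r_{s-1})}{r_s},$$ where, for a given $b=(b_1,\dots,b_j)$, $t_1,\dots,t_l$ are the distinct values among $b_1,\dots,b_j$ and $r_s$ is the number of parts equal to $t_s$ (with $r_0=0$).
   Context: A weight on $\mathbb{F}_q$ is a map $w:\mathbb{F}_q\to\mathbb{N}\cup\{0\}$ with $w(\alpha)=0$ iff $\alpha=0$, $w(-\alpha)=w(\alpha)$, $w(\alpha+\beta)\le w(\alpha)+w(\beta)$; $M_w=\max_\alpha w(\alpha)$; $\tilde w^k(v)=\max_t w(v_t)$ for $v\in\mathbb{F}_q^k$; $D_r^k=\{u\in\mathbb{F}_q^k:\tilde w^k(u)=r\}$. Ideals of $P$ are down-closed subsets; $\langle A\rangle$ is the ideal generated by $A$; $Max(I)$ is the set of maximal elements of $I$; $\mathcal{I}_j^i$ is the set of ideals of cardinality $i$ with exactly $j$ maximal elements. Writing $x=x_1\oplus\cdots\oplus x_n\in(\mathbb{F}_q^{k})^{\oplus n}=\mathbb{F}_q^N$,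 $supp_\pi(x)=\{i:x_i\ne0\}$, $I_x=\langle supp_\pi(x)\rangle$, $M_x=Max(I_x)$, and $w_{(P,w,\pi)}(x)=\sum_{i\in M_x}\tilde w^{k}(x_i)+|I_x\setminus M_x|\,M_w$; $A_r=\{x:w_{(P,w,\pi)}(x)=r\}$. For integers $m\ge0$, $PRT_m[r]$ is the set of non-increasing sequences $(b_1,\dots,b_t)$ of positive integers with $b_1+\dots+b_t=r-mM_w$, each $b_s\le M_w$ and $1\le t\le n-m$. -}

module Defs where

open import Level using (0ℓ)
open import Data.Nat using (ℕ; zero; suc; _+_; _*_; _∸_; _^_; _≤_; _⊔_; _≡ᵇ_; _≤ᵇ_)
open import Data.Nat.Combinatorics using (_C_)
open import Data.Fin using (Fin; toℕ) renaming (zero to fzero; suc to fsuc)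
open import Data.Fin.Properties using () renaming (_≟_ to _≟ᶠ_)
open import Data.Bool using (Bool; true; false; _∧_; _∨_; not; if_then_else_)
open import Data.List using (List; []; _∷_; map; concatMap; length; foldr; allFin; upTo; tabulate; filterᵇ)
open import Data.Bool.ListAction using (and; or)
open import Data.Nat.ListAction using (sum)
open import Data.Product using (_×_; _,_; ∃)
open import Relation.Binary.PropositionalEquality using (_≡_; _≢_)
open import Relation.Binary using (Rel; Decidable)
open import Relation.Nullary.Decidable using (⌊_⌋)
open import Algebra.Structures using (IsCommutativeRing)

-- The finite field F_q, realised (up to isomorphism) on the carrier Fin q,
-- with propositional equality.

record FiniteField (q : ℕ) : Set where
  field
    _+F_ _*F_ : Fin q → Fin q → Fin q
    -F_       : Fin q → Fin q
    0F 1F     : Fin q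
    isCommutativeRing : IsCommutativeRing _≡_ _+F_ _*F_ -F_ 0F 1F
    0≢1       : 0F ≢ 1F
    inverse   : ∀ x → x ≢ 0F → ∃ λ y → x *F y ≡ 1F

record IsWeight {q : ℕ} (F : FiniteField q) (w : Fin q → ℕ) : Set where
  open FiniteField F
  field
    zero⇒0   : ∀ α → w α ≡ 0 → α ≡ 0F
    0⇒zero   : w 0F ≡ 0
    symm     : ∀ α → w (-F α) ≡ w α
    triangle : ∀ α β → w (α +F β) ≤ w α + w β

maxWeight : {q : ℕ} → (Fin q → ℕ) → ℕ
maxWeight {q} w = foldr (λ a m → w a ⊔ m) 0 (allFin q)

allFuns : {A : Set} → List A → (m : ℕ) → List (Fin m → A)
allFuns xs zero = (λ ()) ∷ []
allFuns {A} xs (suc m) = concatMap (λ a → map (ext a) (allFuns xs m)) xs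
  where
  ext : A → (Fin m → A) → Fin (suc m) → A
  ext a f fzero    = a
  ext a f (fsuc i) = f i

countB : {A : Set} → (A → Bool) → List A → ℕ
countB p [] = 0
countB p (x ∷ xs) = (if p x then 1 else 0) + countB p xs

sumOver : {A : Set} → List A → (A → ℕ) → ℕ
sumOver xs f = sum (map f xs)

oneTo : ℕ → List ℕ
oneTo m = map suc (upTo m)

nonIncreasing : List ℕ → Bool
nonIncreasing []           = true
nonIncreasing (x ∷ [])     = true
nonIncreasing (x ∷ y ∷ xs) = (y ≤ᵇ x) ∧ nonIncreasing (y ∷ xs)

-- For a non-increasing b, runs b = ((t_1 , r_1) , … , (t_l , r_l)):
-- t_1 > … > t_l the distinct values of b, r_s = number of parts equal to t_s.
insRun : ℕ → List (ℕ × ℕ) → List (ℕ × ℕ)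
insRun x [] = (x , 1) ∷ []
insRun x ((y , c) ∷ rs) = if x ≡ᵇ y then (y , suc c) ∷ rs else (x , 1) ∷ (y , c) ∷ rs

runs : List ℕ → List (ℕ × ℕ)
runs []       = []
runs (x ∷ xs) = insRun x (runs xs)

-- ∏_{s} D(t_s)^{r_s} * binom(j - (r_1+…+r_{s-1}), r_s); 'used' = r_1+…+r_{s-1}
prodTerm : (ℕ → ℕ) → ℕ → ℕ → List (ℕ × ℕ) → ℕ
prodTerm D j used [] = 1
prodTerm D j used ((t , r) ∷ rs) = (D t ^ r * ((j ∸ used) C r)) * prodTerm D j (used + r) rs

-- The setting: poset P on [n] (= Fin n) with decidable order, field F_q,
-- weight w, label map with k_i = k for all i.

module Setting (n q k : ℕ) (F : FiniteField q) (w : Fin q → ℕ)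
               (_≼_ : Rel (Fin n) 0ℓ) (_≼?_ : Decidable _≼_) where
  open FiniteField F

  Mw : ℕ
  Mw = maxWeight w

  vecs : (m : ℕ) → List (Fin m → Fin q)
  vecs m = allFuns (allFin q) m

  wt : (Fin k → Fin q) → ℕ
  wt v = foldr (λ t m → w (v t) ⊔ m) 0 (allFin k)

  Dcard : ℕ → ℕ
  Dcard r = countB (λ u → wt u ≡ᵇ r) (vecs k)

  Subset : Set
  Subset = Fin n → Bool

  anyFin : (Fin n → Bool) → Bool
  anyFin p = or (map p (allFin n))

  allFin? : (Fin n → Bool) → Bool
  allFin? p = and (map p (allFin n))

  card : Subset → ℕ
  card S = countB S (allFin n)

  _≺ᵇ_ : Fin n → Fin n → Bool
  i ≺ᵇ j = ⌊ i ≼? j ⌋ ∧ not ⌊ i ≟ᶠ j ⌋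

  isMax : Subset → Fin n → Bool
  isMax S i = S i ∧ not (anyFin (λ j → S j ∧ (i ≺ᵇ j)))

  isIdeal : Subset → Bool
  isIdeal S = allFin? (λ a → allFin? (λ b → not (S a ∧ ⌊ b ≼? a ⌋) ∨ S b))

  generated : Subset → Subset
  generated A j = anyFin (λ i → A i ∧ ⌊ j ≼? i ⌋)

  -- elements x = x_1 ⊕ … ⊕ x_n of (F_q^k)^n = F_q^N
  Word : Set
  Word = Fin n → Fin k → Fin q

  allWords : List Word
  allWords = allFuns (vecs k) n

  isZeroVec : (Fin k → Fin q) → Bool
  isZeroVec u = and (map (λ t → ⌊ u t ≟ᶠ 0F ⌋) (allFin k))

  supp : Word → Subset
  supp x i = not (isZeroVec (x i))

  Ix : Word → Subset
  Ix x = generated (supp x)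

  pwWeight : Word → ℕ
  pwWeight x = sumOver (allFin n) (λ i → if isMax (Ix x) i then wt (x i) else 0)
             + countB (λ i → Ix x i ∧ not (isMax (Ix x) i)) (allFin n) * Mw

  Acard : ℕ → ℕ
  Acard r = countB (λ x → pwWeight x ≡ᵇ r) allWords

  idealsIJ : ℕ → ℕ → List Subset
  idealsIJ i j = filterᵇ (λ S → isIdeal S ∧ (card S ≡ᵇ i) ∧ (countB (isMax S) (allFin n) ≡ᵇ j))
                   (allFuns (true ∷ false ∷ []) n)

  inPRT : ℕ → ℕ → List ℕ → Bool
  inPRT m r b = nonIncreasing b ∧ ((sum b + m * Mw) ≡ᵇ r)
                ∧ (1 ≤ᵇ length b) ∧ (length b ≤ᵇ (n ∸ m))

  prtParts : ℕ → ℕ → ℕ → List (List ℕ)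
  prtParts m r j = filterᵇ (λ b → inPRT m r b)
                     (map (λ f → tabulate f) (allFuns (oneTo Mw) j))

  rhs : ℕ → ℕ
  rhs r = sumOver (oneTo n) λ i → sumOver (oneTo i) λ j →
            sumOver (idealsIJ i j) λ I → sumOver (prtParts (i ∸ j) r j) λ b →
              q ^ (k * (i ∸ j)) * prodTerm Dcard j 0 (runs b)

-- Group the words x by their ideal I = I_x. If |I| = i and |Max(I)| = j, then I_x = I exactly when
-- x vanishes off I and is nonzero on Max(I), and then w(x) = (i - j) M_w + Σ_{s ∈ Max(I)} w̃(x_s).
-- The blocks in I \ Max(I) are free, giving q^{k(i-j)}; the maximal blocks give the number of
-- j-tuples of nonzero vectors of total weight r - (i - j) M_w, i.e. Σ ∏ |D_{a_s}| over compositions a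
-- of that number into j parts at most M_w. Collecting the compositions with the same sorted
-- rearrangement b gives the multinomial coefficient ∏_s C(j - (r_1 + ⋯ + r_{s-1}), r_s); this is
-- proved by induction on the largest allowed part, splitting off the run of largest parts by Pascal's rule.

module Submission where

open import Defs
open import Level using (0ℓ)
open import Data.Nat using (ℕ; zero; suc; _+_; _*_; _∸_; _^_; _≤_; _<_; _⊔_; _≡ᵇ_; _≤ᵇ_; z≤n; s≤s)
open import Data.Nat.Properties
open import Algebra.Properties.CommutativeSemigroup +-commutativeSemigroup
  using () renaming (interchange to +-interchange; x∙yz≈y∙xz to +-exchange)
open import Data.Nat.Combinatorics using (_C_; nCk+nC[k+1]≡[n+1]C[k+1]; k>n⇒nCk≡0)
open import Data.Nat.ListAction using (sum)
open import Data.Nat.ListAction.Properties using (sum-++)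
open import Data.Nat.Tactic.RingSolver using (solve-∀)
open import Data.Fin using (Fin) renaming (zero to fzero; suc to fsuc)
open import Data.Fin.Properties using () renaming (_≟_ to _≟ᶠ_; suc-injective to fsuc-injective)
open import Data.Bool using (Bool; true; false; _∧_; _∨_; not; if_then_else_)
open import Data.Bool.Properties using (∧-zeroʳ; ∧-identityʳ; T-≡) renaming (_≟_ to _≟ᵇ_)
open import Data.Bool.ListAction using (and; or)
open import Data.List using (List; []; _∷_; map; foldr; concatMap; length; allFin; upTo; tabulate; filterᵇ; replicate; _++_)
open import Data.List.Properties using (map-++; length-tabulate; applyUpTo-∷ʳ)
open import Data.Product using (_×_; _,_; ∃; proj₁; proj₂)
open import Data.Sum using (inj₁; inj₂)
open import Data.Empty using (⊥-elim)
open import Data.Unit using (⊤; tt)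
open import Function using (_∘_; id; Equivalence)
open import Relation.Binary using (Rel; IsDecPartialOrder; DecidableEquality)
open import Relation.Binary.PropositionalEquality
open import Relation.Nullary using (¬_; Dec; yes; no)
open import Relation.Nullary.Decidable using (⌊_⌋; ⌊⌋-map′; isYes≗does; dec-true; dec-false)

𝟙 : Bool → ℕ
𝟙 b = if b then 1 else 0

𝟙-∧ : ∀ x y → 𝟙 (x ∧ y) ≡ 𝟙 x * 𝟙 y
𝟙-∧ true  y = sym (+-identityʳ (𝟙 y))
𝟙-∧ false y = refl

≡ᵇ-refl : ∀ m → (m ≡ᵇ m) ≡ true
≡ᵇ-refl m = Equivalence.to T-≡ (≡⇒≡ᵇ m m refl)

≢⇒≡ᵇ-false : ∀ m n → m ≢ n → (m ≡ᵇ n) ≡ false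
≢⇒≡ᵇ-false m n m≢n with m ≡ᵇ n in eq
... | false = refl
... | true  = ⊥-elim (m≢n (≡ᵇ⇒≡ m n (Equivalence.from T-≡ eq)))

≡ᵇ-comm : ∀ m n → (m ≡ᵇ n) ≡ (n ≡ᵇ m)
≡ᵇ-comm zero    zero    = refl
≡ᵇ-comm zero    (suc n) = refl
≡ᵇ-comm (suc m) zero    = refl
≡ᵇ-comm (suc m) (suc n) = ≡ᵇ-comm m n

𝟙-≤ᵇ-suc : ∀ a v → 𝟙 (a ≤ᵇ suc v) ≡ 𝟙 (a ≡ᵇ suc v) + 𝟙 (a ≤ᵇ v)
𝟙-≤ᵇ-suc zero          v       = refl
𝟙-≤ᵇ-suc (suc zero)    zero    = refl
𝟙-≤ᵇ-suc (suc (suc a)) zero    = refl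
𝟙-≤ᵇ-suc (suc zero)    (suc v) = refl
𝟙-≤ᵇ-suc (suc (suc a)) (suc v) = 𝟙-≤ᵇ-suc (suc a) v

∧≡true⁻ : ∀ {x y} → x ∧ y ≡ true → x ≡ true × y ≡ true
∧≡true⁻ {true} {true} _ = refl , refl

∧≡true⁺ : ∀ {x y} → x ≡ true → y ≡ true → x ∧ y ≡ true
∧≡true⁺ refl refl = refl

⌊⌋≡true⁻ : ∀ {P : Set} (d : Dec P) → ⌊ d ⌋ ≡ true → P
⌊⌋≡true⁻ (yes p) _ = p

⌊⌋≡true⁺ : ∀ {P : Set} (d : Dec P) → P → ⌊ d ⌋ ≡ true
⌊⌋≡true⁺ d p = trans (isYes≗does d) (dec-true d p)

⌊⌋≡false⁺ : ∀ {P : Set} (d : Dec P) → ¬ P → ⌊ d ⌋ ≡ false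
⌊⌋≡false⁺ d ¬p = trans (isYes≗does d) (dec-false d ¬p)

⌊⌋≡false⁻ : ∀ {P : Set} (d : Dec P) → ⌊ d ⌋ ≡ false → ¬ P
⌊⌋≡false⁻ (no ¬p) _ = ¬p

not≡true⁻ : ∀ {b} → not b ≡ true → b ≡ false
not≡true⁻ {false} _ = refl

module _ {A : Set} where

  sumOver-cong : (L : List A) {f g : A → ℕ} → (∀ x → f x ≡ g x) → sumOver L f ≡ sumOver L g
  sumOver-cong []      f≗g = refl
  sumOver-cong (x ∷ L) f≗g = cong₂ _+_ (f≗g x) (sumOver-cong L f≗g)

  sumOver-++ : (L M : List A) (f : A → ℕ) → sumOver (L ++ M) f ≡ sumOver L f + sumOver M f
  sumOver-++ L M f = trans (cong sum (map-++ f L M)) (sum-++ (map f L) (map f M))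

  sumOver-+ : (L : List A) (f g : A → ℕ) → sumOver L (λ x → f x + g x) ≡ sumOver L f + sumOver L g
  sumOver-+ []      f g = refl
  sumOver-+ (x ∷ L) f g =
    trans (cong (f x + g x +_) (sumOver-+ L f g)) (+-interchange (f x) (g x) (sumOver L f) (sumOver L g))

  sumOver-*ˡ : (L : List A) (c : ℕ) (f : A → ℕ) → sumOver L (λ x → c * f x) ≡ c * sumOver L f
  sumOver-*ˡ []      c f = sym (*-zeroʳ c)
  sumOver-*ˡ (x ∷ L) c f = trans (cong (c * f x +_) (sumOver-*ˡ L c f)) (sym (*-distribˡ-+ c (f x) _))

  sumOver-zero : (L : List A) {f : A → ℕ} → (∀ x → f x ≡ 0) → sumOver L f ≡ 0
  sumOver-zero []      f≗0 = refl
  sumOver-zero (x ∷ L) f≗0 = cong₂ _+_ (f≗0 x) (sumOver-zero L f≗0)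

  sumOver-const : (L : List A) (c : ℕ) → sumOver L (λ _ → c) ≡ length L * c
  sumOver-const []      c = refl
  sumOver-const (x ∷ L) c = cong (c +_) (sumOver-const L c)

  sumOver-filterᵇ : (p : A → Bool) (L : List A) (f : A → ℕ) →
                    sumOver (filterᵇ p L) f ≡ sumOver L (λ x → 𝟙 (p x) * f x)
  sumOver-filterᵇ p []      f = refl
  sumOver-filterᵇ p (x ∷ L) f with p x
  ... | true  = cong₂ _+_ (sym (+-identityʳ (f x))) (sumOver-filterᵇ p L f)
  ... | false = sumOver-filterᵇ p L f

  countB≡sumOver-𝟙 : (p : A → Bool) (L : List A) → countB p L ≡ sumOver L (𝟙 ∘ p)
  countB≡sumOver-𝟙 p []      = refl
  countB≡sumOver-𝟙 p (x ∷ L) = cong (𝟙 (p x) +_) (countB≡sumOver-𝟙 p L)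

  countB-cong : (L : List A) {p p′ : A → Bool} → (∀ x → p x ≡ p′ x) → countB p L ≡ countB p′ L
  countB-cong L {p} {p′} p≗p′ =
    trans (countB≡sumOver-𝟙 p L) (trans (sumOver-cong L (cong 𝟙 ∘ p≗p′)) (sym (countB≡sumOver-𝟙 p′ L)))

  countB-false : (L : List A) → countB (λ _ → false) L ≡ 0
  countB-false L = trans (countB≡sumOver-𝟙 _ L) (sumOver-zero L (λ _ → refl))

  countB-∧-const : (L : List A) (b : Bool) (p r : A → Bool) →
                   countB (λ x → (b ∧ p x) ∧ r x) L ≡ 𝟙 b * countB (λ x → p x ∧ r x) L
  countB-∧-const L true  p r = sym (+-identityʳ _)
  countB-∧-const L false p r = countB-false L

module _ {A B : Set} where

  sumOver-map : (L : List A) (g : A → B) (f : B → ℕ) → sumOver (map g L) f ≡ sumOver L (f ∘ g)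
  sumOver-map []      g f = refl
  sumOver-map (x ∷ L) g f = cong (f (g x) +_) (sumOver-map L g f)

  sumOver-concatMap : (L : List A) (g : A → List B) (f : B → ℕ) →
                      sumOver (concatMap g L) f ≡ sumOver L (λ a → sumOver (g a) f)
  sumOver-concatMap []      g f = refl
  sumOver-concatMap (x ∷ L) g f =
    trans (sumOver-++ (g x) (concatMap g L) f) (cong (sumOver (g x) f +_) (sumOver-concatMap L g f))

  sumOver-comm : (L : List A) (M : List B) (h : A → B → ℕ) →
                 sumOver L (λ x → sumOver M (h x)) ≡ sumOver M (λ y → sumOver L (λ x → h x y))
  sumOver-comm []      M h = sym (sumOver-zero M (λ _ → refl))
  sumOver-comm (x ∷ L) M h =
    trans (cong (sumOver M (h x) +_) (sumOver-comm L M h)) (sym (sumOver-+ M (h x) _))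

sumOver-oneTo-suc : ∀ m (G : ℕ → ℕ) → sumOver (oneTo (suc m)) G ≡ sumOver (oneTo m) G + G (suc m)
sumOver-oneTo-suc m G = begin
  sumOver (oneTo (suc m)) G                   ≡⟨ cong (λ L → sumOver (map suc L) G) (sym (applyUpTo-∷ʳ id m)) ⟩
  sumOver (map suc (upTo m ++ m ∷ [])) G      ≡⟨ cong (λ L → sumOver L G) (map-++ suc (upTo m) (m ∷ [])) ⟩
  sumOver (oneTo m ++ suc m ∷ []) G           ≡⟨ sumOver-++ (oneTo m) (suc m ∷ []) G ⟩
  sumOver (oneTo m) G + (G (suc m) + 0)       ≡⟨ cong (sumOver (oneTo m) G +_) (+-identityʳ (G (suc m))) ⟩
  sumOver (oneTo m) G + G (suc m)             ∎
  where open ≡-Reasoning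

sumOver-oneTo-cong : ∀ m {G G′ : ℕ → ℕ} → (∀ a → a ≤ m → G a ≡ G′ a) →
                     sumOver (oneTo m) G ≡ sumOver (oneTo m) G′
sumOver-oneTo-cong zero    G≗G′ = refl
sumOver-oneTo-cong (suc m) {G} {G′} G≗G′ = begin
  sumOver (oneTo (suc m)) G        ≡⟨ sumOver-oneTo-suc m G ⟩
  sumOver (oneTo m) G + G (suc m)
    ≡⟨ cong₂ _+_ (sumOver-oneTo-cong m (λ a a≤m → G≗G′ a (m≤n⇒m≤1+n a≤m))) (G≗G′ (suc m) ≤-refl) ⟩
  sumOver (oneTo m) G′ + G′ (suc m) ≡⟨ sym (sumOver-oneTo-suc m G′) ⟩
  sumOver (oneTo (suc m)) G′       ∎
  where open ≡-Reasoning

sumOver-oneTo-zero : ∀ m (G : ℕ → ℕ) → (∀ a → G (suc a) ≡ 0) → sumOver (oneTo m) G ≡ 0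
sumOver-oneTo-zero m G G≗0 = trans (sumOver-map (upTo m) suc G) (sumOver-zero (upTo m) (G≗0))

sumOver-oneTo-select-∉ : ∀ m a (G : ℕ → ℕ) → m < a → sumOver (oneTo m) (λ s → 𝟙 (s ≡ᵇ a) * G s) ≡ 0
sumOver-oneTo-select-∉ zero    a G m<a = refl
sumOver-oneTo-select-∉ (suc m) a G m<a =
  trans (sumOver-oneTo-suc m _)
        (cong₂ _+_ (sumOver-oneTo-select-∉ m a G (<-trans (n<1+n m) m<a))
                   (cong (λ b → 𝟙 b * G (suc m)) (≢⇒≡ᵇ-false (suc m) a (λ e → <-irrefl e m<a))))

sumOver-oneTo-select : ∀ m a (G : ℕ → ℕ) → 1 ≤ a → a ≤ m → sumOver (oneTo m) (λ s → 𝟙 (s ≡ᵇ a) * G s) ≡ G a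
sumOver-oneTo-select zero    a G 1≤a a≤0 = ⊥-elim (<-irrefl refl (≤-trans 1≤a a≤0))
sumOver-oneTo-select (suc m) a G 1≤a a≤1+m with m≤n⇒m<n∨m≡n a≤1+m
... | inj₁ a≤m =
  trans (sumOver-oneTo-suc m _)
        (trans (cong₂ _+_ (sumOver-oneTo-select m a G 1≤a (≤-pred a≤m))
                          (cong (λ b → 𝟙 b * G (suc m)) (≢⇒≡ᵇ-false (suc m) a (λ e → <-irrefl (sym e) a≤m))))
               (+-identityʳ (G a)))
... | inj₂ refl =
  trans (sumOver-oneTo-suc m _)
        (trans (cong₂ _+_ (sumOver-oneTo-select-∉ m (suc m) G (n<1+n m)) (cong (λ b → 𝟙 b * G (suc m)) (≡ᵇ-refl m)))
               (+-identityʳ (G (suc m))))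

allᶠ : ∀ {m} → (Fin m → Bool) → Bool
allᶠ {zero}  p = true
allᶠ {suc m} p = p fzero ∧ allᶠ (p ∘ fsuc)

anyᶠ : ∀ {m} → (Fin m → Bool) → Bool
anyᶠ {zero}  p = false
anyᶠ {suc m} p = p fzero ∨ anyᶠ (p ∘ fsuc)

countᶠ : ∀ {m} → (Fin m → Bool) → ℕ
countᶠ {zero}  p = 0
countᶠ {suc m} p = 𝟙 (p fzero) + countᶠ (p ∘ fsuc)

sumᶠ : ∀ {m} → (Fin m → ℕ) → ℕ
sumᶠ {zero}  f = 0
sumᶠ {suc m} f = f fzero + sumᶠ (f ∘ fsuc)

maxᶠ : ∀ {m} → (Fin m → ℕ) → ℕ
maxᶠ {zero}  f = 0
maxᶠ {suc m} f = f fzero ⊔ maxᶠ (f ∘ fsuc)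

module _ {A : Set} where

  and-map-tabulate : ∀ {m} (g : Fin m → A) (p : A → Bool) → and (map p (tabulate g)) ≡ allᶠ (p ∘ g)
  and-map-tabulate {zero}  g p = refl
  and-map-tabulate {suc m} g p = cong (p (g fzero) ∧_) (and-map-tabulate (g ∘ fsuc) p)

  or-map-tabulate : ∀ {m} (g : Fin m → A) (p : A → Bool) → or (map p (tabulate g)) ≡ anyᶠ (p ∘ g)
  or-map-tabulate {zero}  g p = refl
  or-map-tabulate {suc m} g p = cong (p (g fzero) ∨_) (or-map-tabulate (g ∘ fsuc) p)

  countB-tabulate : ∀ {m} (g : Fin m → A) (p : A → Bool) → countB p (tabulate g) ≡ countᶠ (p ∘ g)
  countB-tabulate {zero}  g p = refl
  countB-tabulate {suc m} g p = cong (𝟙 (p (g fzero)) +_) (countB-tabulate (g ∘ fsuc) p)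

  sumOver-tabulate : ∀ {m} (g : Fin m → A) (f : A → ℕ) → sumOver (tabulate g) f ≡ sumᶠ (f ∘ g)
  sumOver-tabulate {zero}  g f = refl
  sumOver-tabulate {suc m} g f = cong (f (g fzero) +_) (sumOver-tabulate (g ∘ fsuc) f)

  foldr-⊔-tabulate : ∀ {m} (g : Fin m → A) (f : A → ℕ) → foldr (λ t r → f t ⊔ r) 0 (tabulate g) ≡ maxᶠ (f ∘ g)
  foldr-⊔-tabulate {zero}  g f = refl
  foldr-⊔-tabulate {suc m} g f = cong (f (g fzero) ⊔_) (foldr-⊔-tabulate (g ∘ fsuc) f)

allᶠ⇒∀ : ∀ {m} (p : Fin m → Bool) → allᶠ p ≡ true → ∀ i → p i ≡ true
allᶠ⇒∀ p all-p fzero    = proj₁ (∧≡true⁻ all-p)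
allᶠ⇒∀ p all-p (fsuc i) = allᶠ⇒∀ (p ∘ fsuc) (proj₂ (∧≡true⁻ {p fzero} all-p)) i

∀⇒allᶠ : ∀ {m} (p : Fin m → Bool) → (∀ i → p i ≡ true) → allᶠ p ≡ true
∀⇒allᶠ {zero}  p ∀p = refl
∀⇒allᶠ {suc m} p ∀p = ∧≡true⁺ (∀p fzero) (∀⇒allᶠ (p ∘ fsuc) (∀p ∘ fsuc))

allᶠ-false⇒∃ : ∀ {m} (p : Fin m → Bool) → allᶠ p ≡ false → ∃ λ i → p i ≡ false
allᶠ-false⇒∃ {suc m} p all-p with p fzero in eq
... | false = fzero , eq
... | true  = let i , pi = allᶠ-false⇒∃ (p ∘ fsuc) all-p in fsuc i , pi

anyᶠ⇒∃ : ∀ {m} (p : Fin m → Bool) → anyᶠ p ≡ true → ∃ λ i → p i ≡ true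
anyᶠ⇒∃ {suc m} p any-p with p fzero in eq
... | true  = fzero , eq
... | false = let i , pi = anyᶠ⇒∃ (p ∘ fsuc) any-p in fsuc i , pi

∃⇒anyᶠ : ∀ {m} (p : Fin m → Bool) i → p i ≡ true → anyᶠ p ≡ true
∃⇒anyᶠ p fzero    pi rewrite pi = refl
∃⇒anyᶠ p (fsuc i) pi with p fzero
... | true  = refl
... | false = ∃⇒anyᶠ (p ∘ fsuc) i pi

anyᶠ-cong : ∀ {m} {p p′ : Fin m → Bool} → (∀ i → p i ≡ p′ i) → anyᶠ p ≡ anyᶠ p′
anyᶠ-cong {zero}  p≗p′ = refl
anyᶠ-cong {suc m} p≗p′ = cong₂ _∨_ (p≗p′ fzero) (anyᶠ-cong (p≗p′ ∘ fsuc))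

sumᶠ-cong : ∀ {m} {f g : Fin m → ℕ} → (∀ i → f i ≡ g i) → sumᶠ f ≡ sumᶠ g
sumᶠ-cong {zero}  f≗g = refl
sumᶠ-cong {suc m} f≗g = cong₂ _+_ (f≗g fzero) (sumᶠ-cong (f≗g ∘ fsuc))

sumᶠ-zero : ∀ m → sumᶠ {m} (λ _ → 0) ≡ 0
sumᶠ-zero zero    = refl
sumᶠ-zero (suc m) = sumᶠ-zero m

sumᶠ-𝟙-≟ : ∀ {m} (y : Fin m) c → sumᶠ (λ i → 𝟙 ⌊ i ≟ᶠ y ⌋ * c) ≡ c
sumᶠ-𝟙-≟ {suc m} fzero    c = trans (cong (c + 0 +_) (sumᶠ-zero m)) (trans (+-identityʳ _) (+-identityʳ c))
sumᶠ-𝟙-≟ {suc m} (fsuc y) c =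
  trans (sumᶠ-cong (λ i → cong (λ b → 𝟙 b * c) (⌊⌋-map′ (cong fsuc) fsuc-injective (i ≟ᶠ y)))) (sumᶠ-𝟙-≟ y c)

countᶠ-cong : ∀ {m} {p p′ : Fin m → Bool} → (∀ i → p i ≡ p′ i) → countᶠ p ≡ countᶠ p′
countᶠ-cong {zero}  p≗p′ = refl
countᶠ-cong {suc m} p≗p′ = cong₂ _+_ (cong 𝟙 (p≗p′ fzero)) (countᶠ-cong (p≗p′ ∘ fsuc))

countᶠ≤ : ∀ {m} (p : Fin m → Bool) → countᶠ p ≤ m
countᶠ≤ {zero}  p = z≤n
countᶠ≤ {suc m} p with p fzero
... | true  = s≤s (countᶠ≤ (p ∘ fsuc))
... | false = m≤n⇒m≤1+n (countᶠ≤ (p ∘ fsuc))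

countᶠ-pos : ∀ {m} (p : Fin m → Bool) i → p i ≡ true → 1 ≤ countᶠ p
countᶠ-pos p fzero    pi rewrite pi = s≤s z≤n
countᶠ-pos p (fsuc i) pi = ≤-trans (countᶠ-pos (p ∘ fsuc) i pi) (m≤n+m _ (𝟙 (p fzero)))

countᶠ-pos⇒∃ : ∀ {m} (p : Fin m → Bool) → 1 ≤ countᶠ p → ∃ λ i → p i ≡ true
countᶠ-pos⇒∃ {suc m} p 1≤c with p fzero in eq
... | true  = fzero , eq
... | false = let i , pi = countᶠ-pos⇒∃ (p ∘ fsuc) 1≤c in fsuc i , pi

countᶠ-split : ∀ {m} (p q : Fin m → Bool) → (∀ i → q i ≡ true → p i ≡ true) →
               countᶠ p ≡ countᶠ (λ i → p i ∧ not (q i)) + countᶠ q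
countᶠ-split {zero}  p q q⊆p = refl
countᶠ-split {suc m} p q q⊆p with p fzero in p0 | q fzero in q0
... | true  | true  = trans (cong suc (countᶠ-split (p ∘ fsuc) (q ∘ fsuc) (q⊆p ∘ fsuc))) (sym (+-suc _ _))
... | true  | false = cong suc (countᶠ-split (p ∘ fsuc) (q ∘ fsuc) (q⊆p ∘ fsuc))
... | false | false = countᶠ-split (p ∘ fsuc) (q ∘ fsuc) (q⊆p ∘ fsuc)
... | false | true  with () ← trans (sym (q⊆p fzero q0)) p0

countᶠ-mono : ∀ {m} (p p′ : Fin m → Bool) → (∀ i → p i ≡ true → p′ i ≡ true) → countᶠ p ≤ countᶠ p′
countᶠ-mono p p′ p⊆p′ = subst (countᶠ p ≤_) (sym (countᶠ-split p′ p p⊆p′)) (m≤n+m (countᶠ p) _)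

countᶠ-strict : ∀ {m} (p p′ : Fin m → Bool) → (∀ i → p i ≡ true → p′ i ≡ true) →
                ∀ y → p′ y ≡ true → p y ≡ false → countᶠ p < countᶠ p′
countᶠ-strict p p′ p⊆p′ y p′y py =
  subst (countᶠ p <_) (sym (countᶠ-split p′ p p⊆p′))
        (+-monoˡ-≤ (countᶠ p) (countᶠ-pos (λ i → p′ i ∧ not (p i)) y (cong₂ (λ a b → a ∧ not b) p′y py)))

maxᶠ-zero : ∀ {m} (f : Fin m → ℕ) → (∀ i → f i ≡ 0) → maxᶠ f ≡ 0
maxᶠ-zero {zero}  f f≗0 = refl
maxᶠ-zero {suc m} f f≗0 = cong₂ _⊔_ (f≗0 fzero) (maxᶠ-zero (f ∘ fsuc) (f≗0 ∘ fsuc))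

f≤maxᶠ : ∀ {m} (f : Fin m → ℕ) i → f i ≤ maxᶠ f
f≤maxᶠ f fzero    = m≤m⊔n (f fzero) _
f≤maxᶠ f (fsuc i) = ≤-trans (f≤maxᶠ (f ∘ fsuc) i) (m≤n⊔m (f fzero) _)

maxᶠ-lub : ∀ {m} (f : Fin m → ℕ) c → (∀ i → f i ≤ c) → maxᶠ f ≤ c
maxᶠ-lub {zero}  f c f≤c = z≤n
maxᶠ-lub {suc m} f c f≤c = ⊔-lub (f≤c fzero) (maxᶠ-lub (f ∘ fsuc) c (f≤c ∘ fsuc))

module _ {A : Set} (xs : List A) where

  sumOver-allFuns-const : ∀ m c → sumOver (allFuns xs m) (λ _ → c) ≡ length xs ^ m * c
  sumOver-allFuns-const zero    c = trans (+-identityʳ c) (sym (*-identityˡ c))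
  sumOver-allFuns-const (suc m) c = begin
    sumOver (allFuns xs (suc m)) (λ _ → c)                      ≡⟨ sumOver-concatMap xs _ _ ⟩
    sumOver xs (λ a → sumOver (map _ (allFuns xs m)) (λ _ → c))
      ≡⟨ sumOver-cong xs (λ a → trans (sumOver-map (allFuns xs m) _ _) (sumOver-allFuns-const m c)) ⟩
    sumOver xs (λ _ → length xs ^ m * c)                        ≡⟨ sumOver-const xs _ ⟩
    length xs * (length xs ^ m * c)                             ≡⟨ *-assoc (length xs) _ c ⟨
    length xs ^ suc m * c                                       ∎
    where open ≡-Reasoning

  -- If every value occurs exactly once in xs, then every g occurs exactly once in allFuns xs m.
  module _ (_≟_ : DecidableEquality A) (xs-unique : ∀ b c → sumOver xs (λ a → 𝟙 ⌊ a ≟ b ⌋ * c) ≡ c) where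

    sumOver-allFuns-≟ : ∀ m (g : Fin m → A) c →
                        sumOver (allFuns xs m) (λ f → 𝟙 (allᶠ (λ i → ⌊ f i ≟ g i ⌋)) * c) ≡ c
    sumOver-allFuns-≟ zero    g c = trans (+-identityʳ _) (+-identityʳ c)
    sumOver-allFuns-≟ (suc m) g c = begin
      sumOver (allFuns xs (suc m)) (λ f → 𝟙 (allᶠ (λ i → ⌊ f i ≟ g i ⌋)) * c)
        ≡⟨ sumOver-concatMap xs _ _ ⟩
      sumOver xs (λ a → sumOver (map _ (allFuns xs m)) (λ f → 𝟙 (allᶠ (λ i → ⌊ f i ≟ g i ⌋)) * c))
        ≡⟨ sumOver-cong xs (λ a → trans (sumOver-map (allFuns xs m) _ _) (fixHead a)) ⟩
      sumOver xs (λ a → 𝟙 ⌊ a ≟ g fzero ⌋ * c)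
        ≡⟨ xs-unique (g fzero) c ⟩
      c ∎
      where
      open ≡-Reasoning
      fixHead : ∀ a → sumOver (allFuns xs m) (λ f → 𝟙 (⌊ a ≟ g fzero ⌋ ∧ allᶠ (λ i → ⌊ f i ≟ g (fsuc i) ⌋)) * c)
                      ≡ 𝟙 ⌊ a ≟ g fzero ⌋ * c
      fixHead a =
        trans (sumOver-cong (allFuns xs m) (λ f →
                 trans (cong (_* c) (𝟙-∧ ⌊ a ≟ g fzero ⌋ _)) (*-assoc (𝟙 ⌊ a ≟ g fzero ⌋) _ c)))
              (trans (sumOver-*ˡ (allFuns xs m) (𝟙 ⌊ a ≟ g fzero ⌋) _)
                     (cong (𝟙 ⌊ a ≟ g fzero ⌋ *_) (sumOver-allFuns-≟ m (g ∘ fsuc) c)))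

allFin-unique : ∀ {q} (b : Fin q) c → sumOver (allFin q) (λ a → 𝟙 ⌊ a ≟ᶠ b ⌋ * c) ≡ c
allFin-unique b c = trans (sumOver-tabulate id (λ a → 𝟙 ⌊ a ≟ᶠ b ⌋ * c)) (sumᶠ-𝟙-≟ b c)

bools-unique : ∀ b c → sumOver (true ∷ false ∷ []) (λ a → 𝟙 ⌊ a ≟ᵇ b ⌋ * c) ≡ c
bools-unique true  c = trans (+-identityʳ _) (+-identityʳ c)
bools-unique false c = trans (+-identityʳ _) (+-identityʳ c)

-- Antidiagonal sums and the binomial convolution

antidiagonal : (ℕ → ℕ → ℕ) → ℕ → ℕ
antidiagonal g zero    = g 0 0
antidiagonal g (suc j) = g 0 (suc j) + antidiagonal (λ e f → g (suc e) f) j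

antidiagonal-cong : ∀ j {g h : ℕ → ℕ → ℕ} → (∀ e f → g e f ≡ h e f) → antidiagonal g j ≡ antidiagonal h j
antidiagonal-cong zero    g≗h = g≗h 0 0
antidiagonal-cong (suc j) g≗h = cong₂ _+_ (g≗h 0 (suc j)) (antidiagonal-cong j (λ e → g≗h (suc e)))

antidiagonal-+ : ∀ j (g h : ℕ → ℕ → ℕ) → antidiagonal (λ e f → g e f + h e f) j ≡ antidiagonal g j + antidiagonal h j
antidiagonal-+ zero    g h = refl
antidiagonal-+ (suc j) g h =
  trans (cong (g 0 (suc j) + h 0 (suc j) +_) (antidiagonal-+ j _ _)) (+-interchange (g 0 (suc j)) (h 0 (suc j)) _ _)

antidiagonal-*ˡ : ∀ j c (g : ℕ → ℕ → ℕ) → antidiagonal (λ e f → c * g e f) j ≡ c * antidiagonal g j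
antidiagonal-*ˡ zero    c g = refl
antidiagonal-*ˡ (suc j) c g =
  trans (cong (c * g 0 (suc j) +_) (antidiagonal-*ˡ j c _)) (sym (*-distribˡ-+ c _ _))

antidiagonal-sumOver : {A : Set} (L : List A) (j : ℕ) (g : A → ℕ → ℕ → ℕ) →
  antidiagonal (λ e f → sumOver L (λ s → g s e f)) j ≡ sumOver L (λ s → antidiagonal (g s) j)
antidiagonal-sumOver L zero    g = refl
antidiagonal-sumOver L (suc j) g =
  trans (cong (sumOver L (λ s → g s 0 (suc j)) +_) (antidiagonal-sumOver L j (λ s e → g s (suc e))))
        (sym (sumOver-+ L (λ s → g s 0 (suc j)) _))

antidiagonal-suc-last : ∀ j (g : ℕ → ℕ → ℕ) → antidiagonal g (suc j) ≡ antidiagonal (λ e f → g e (suc f)) j + g (suc j) 0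
antidiagonal-suc-last zero    g = refl
antidiagonal-suc-last (suc j) g =
  trans (cong (g 0 (suc (suc j)) +_) (antidiagonal-suc-last j (λ e → g (suc e)))) (sym (+-assoc (g 0 (suc (suc j))) _ _))

binomialTerm : (ℕ → ℕ → ℕ) → ℕ → ℕ → ℕ
binomialTerm h e f = ((e + f) C e) * h e f

binomialSum : ℕ → (ℕ → ℕ → ℕ) → ℕ
binomialSum j h = antidiagonal (binomialTerm h) j

binomialSum-cong : ∀ j {g h : ℕ → ℕ → ℕ} → (∀ e f → g e f ≡ h e f) → binomialSum j g ≡ binomialSum j h
binomialSum-cong j g≗h = antidiagonal-cong j (λ e f → cong (((e + f) C e) *_) (g≗h e f))

-- Reindexing e ↦ 1 + e; h 0 (suc j) is the e = 0 term on the right.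
binomialSum-reindex : ∀ j (h : ℕ → ℕ → ℕ) →
  h 0 (suc j) + antidiagonal (λ e f → ((e + f) C suc e) * h (suc e) f) j ≡ binomialSum j (λ e f → h e (suc f))
binomialSum-reindex zero    h = refl
binomialSum-reindex (suc j) h = cong₂ _+_ (sym (*-identityˡ _)) (begin
  antidiagonal g (suc j)                                                  ≡⟨ antidiagonal-suc-last j g ⟩
  antidiagonal (λ e f → g e (suc f)) j + ((suc j + 0) C suc (suc j)) * h (suc (suc j)) 0
    ≡⟨ cong₂ _+_ (antidiagonal-cong j (λ e f → cong (λ t → (t C suc e) * h (suc e) (suc f)) (+-suc e f)))
                 (cong (_* h (suc (suc j)) 0) (k>n⇒nCk≡0 (s≤s (s≤s (≤-reflexive (+-identityʳ j)))))) ⟩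
  antidiagonal (λ e f → ((suc e + f) C suc e) * h (suc e) (suc f)) j + 0  ≡⟨ +-identityʳ _ ⟩
  antidiagonal (λ e f → ((suc e + f) C suc e) * h (suc e) (suc f)) j      ∎)
  where
  open ≡-Reasoning
  g : ℕ → ℕ → ℕ
  g e f = ((e + f) C suc e) * h (suc e) f

binomialSum-suc : ∀ j (h : ℕ → ℕ → ℕ) →
  binomialSum (suc j) h ≡ binomialSum j (λ e f → h (suc e) f) + binomialSum j (λ e f → h e (suc f))
binomialSum-suc j h = begin
  binomialSum (suc j) h
    ≡⟨ cong (_+ antidiagonal (λ e f → ((suc e + f) C suc e) * h (suc e) f) j) (+-identityʳ (h 0 (suc j))) ⟩
  h 0 (suc j) + antidiagonal (λ e f → ((suc e + f) C suc e) * h (suc e) f) j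
    ≡⟨ cong (h 0 (suc j) +_) (antidiagonal-cong j pascal) ⟩
  h 0 (suc j) + antidiagonal (λ e f → ((e + f) C e) * h (suc e) f + ((e + f) C suc e) * h (suc e) f) j
    ≡⟨ cong (h 0 (suc j) +_) (antidiagonal-+ j _ _) ⟩
  h 0 (suc j) + (binomialSum j (λ e f → h (suc e) f) + R)
    ≡⟨ +-exchange (h 0 (suc j)) _ R ⟩
  binomialSum j (λ e f → h (suc e) f) + (h 0 (suc j) + R)
    ≡⟨ cong (binomialSum j (λ e f → h (suc e) f) +_) (binomialSum-reindex j h) ⟩
  binomialSum j (λ e f → h (suc e) f) + binomialSum j (λ e f → h e (suc f)) ∎
  where
  open ≡-Reasoning
  R : ℕ
  R = antidiagonal (λ e f → ((e + f) C suc e) * h (suc e) f) j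
  pascal : ∀ e f → ((suc e + f) C suc e) * h (suc e) f ≡ ((e + f) C e) * h (suc e) f + ((e + f) C suc e) * h (suc e) f
  pascal e f = trans (cong (_* h (suc e) f) (sym (nCk+nC[k+1]≡[n+1]C[k+1] (e + f) e))) (*-distribʳ-+ (h (suc e) f) ((e + f) C e) _)

headAtMost : ℕ → List ℕ → Bool
headAtMost u []      = true
headAtMost u (a ∷ _) = a ≤ᵇ u

nonIncreasing-∷ : ∀ a b → nonIncreasing (a ∷ b) ≡ headAtMost a b ∧ nonIncreasing b
nonIncreasing-∷ a []      = refl
nonIncreasing-∷ a (x ∷ b) = refl

FirstRunNot : ℕ → List (ℕ × ℕ) → Set
FirstRunNot u []            = ⊤
FirstRunNot u ((t , _) ∷ _) = t ≢ u

insRun-firstRunNot : ∀ a u rs → a ≢ u → FirstRunNot u (insRun a rs)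
insRun-firstRunNot a u []             a≢u = a≢u
insRun-firstRunNot a u ((t , c) ∷ rs) a≢u with a ≡ᵇ t in eq
... | true  = λ t≡u → a≢u (trans (≡ᵇ⇒≡ a t (Equivalence.from T-≡ eq)) t≡u)
... | false = a≢u

runs-replicate-++ : ∀ u c ys → FirstRunNot u (runs ys) → runs (replicate (suc c) u ++ ys) ≡ (u , suc c) ∷ runs ys
runs-replicate-++ u zero ys u∉ with runs ys
... | []            = refl
... | (t , _) ∷ rs rewrite ≢⇒≡ᵇ-false u t (λ e → u∉ (sym e)) = refl
runs-replicate-++ u (suc c) ys u∉ rewrite runs-replicate-++ u c ys u∉ | ≡ᵇ-refl u = refl

module _ (D : ℕ → ℕ) where

  prodTerm-+ : ∀ c j used rs → prodTerm D (c + j) (c + used) rs ≡ prodTerm D j used rs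
  prodTerm-+ c j used []             = refl
  prodTerm-+ c j used ((t , r) ∷ rs) =
    cong₂ (λ x y → (D t ^ r * (x C r)) * y) ([m+n]∸[m+o]≡n∸o c j used)
          (trans (cong (λ z → prodTerm D (c + j) z rs) (+-assoc c used r)) (prodTerm-+ c j (used + r) rs))

  prodTerm-replicate-++ : ∀ u c j ys → FirstRunNot u (runs ys) →
    prodTerm D (c + j) 0 (runs (replicate c u ++ ys)) ≡ ((c + j) C c) * (D u ^ c * prodTerm D j 0 (runs ys))
  prodTerm-replicate-++ u zero    j ys u∉ = sym (trans (*-identityˡ _) (*-identityˡ _))
  prodTerm-replicate-++ u (suc c) j ys u∉ rewrite runs-replicate-++ u c ys u∉ =
    trans (cong ((D u ^ suc c * ((suc c + j) C suc c)) *_)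
                (trans (cong (λ z → prodTerm D (suc c + j) z (runs ys)) (sym (+-identityʳ (suc c))))
                       (prodTerm-+ (suc c) j 0 (runs ys))))
          (rearrange (D u ^ suc c) ((suc c + j) C suc c) _)
    where
    rearrange : ∀ a b z → (a * b) * z ≡ b * (a * z)
    rearrange = solve-∀

-- Compositions and partitions

shift : (ℕ → Bool) → ℕ → ℕ → Bool
shift φ s t = φ (s + t)

replicate-++-∷ : ∀ c (u : ℕ) b → replicate c u ++ (u ∷ b) ≡ u ∷ (replicate c u ++ b)
replicate-++-∷ zero    u b = refl
replicate-++-∷ (suc c) u b = cong (u ∷_) (replicate-++-∷ c u b)

module Partitions (D : ℕ → ℕ) (M : ℕ) where

  sumTuples : ℕ → (List ℕ → ℕ) → ℕ
  sumTuples j F = sumOver (allFuns (oneTo M) j) (λ f → F (tabulate f))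

  sumTuples-suc : ∀ j F → sumTuples (suc j) F ≡ sumOver (oneTo M) (λ a → sumTuples j (λ b → F (a ∷ b)))
  sumTuples-suc j F =
    trans (sumOver-concatMap (oneTo M) _ _) (sumOver-cong (oneTo M) (λ a → sumOver-map (allFuns (oneTo M) j) _ _))

  sumTuples-cong : ∀ j {F G : List ℕ → ℕ} → (∀ b → F b ≡ G b) → sumTuples j F ≡ sumTuples j G
  sumTuples-cong j F≗G = sumOver-cong (allFuns (oneTo M) j) (λ f → F≗G (tabulate f))

  sumTuples-*ˡ : ∀ j c F → sumTuples j (λ b → c * F b) ≡ c * sumTuples j F
  sumTuples-*ˡ j c F = sumOver-*ˡ (allFuns (oneTo M) j) c _

  sumTuples-zero : ∀ j → sumTuples j (λ _ → 0) ≡ 0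
  sumTuples-zero j = sumOver-zero (allFuns (oneTo M) j) (λ _ → refl)

  -- Σ ∏ᵢ D(aᵢ) over the words a ∈ [1..v]^j with φ(a₁ + ⋯ + a_j).
  compositions : ℕ → ℕ → (ℕ → Bool) → ℕ
  compositions v zero    φ = 𝟙 (φ 0)
  compositions v (suc j) φ = sumOver (oneTo v) (λ s → D s * compositions v j (shift φ s))

  compositions-cong : ∀ v j {φ ψ : ℕ → Bool} → (∀ s → φ s ≡ ψ s) → compositions v j φ ≡ compositions v j ψ
  compositions-cong v zero    φ≗ψ = cong 𝟙 (φ≗ψ 0)
  compositions-cong v (suc j) φ≗ψ =
    sumOver-cong (oneTo v) (λ s → cong (D s *_) (compositions-cong v j (λ t → φ≗ψ (s + t))))

  partitions : ℕ → ℕ → (ℕ → Bool) → ℕ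
  partitions v j φ = sumTuples j (λ b → 𝟙 (headAtMost v b ∧ nonIncreasing b) * (𝟙 (φ (sum b)) * prodTerm D j 0 (runs b)))

  -- The contribution of a leading run of e parts equal to 1 + v, followed by f parts at most v.
  leadingRun : (ℕ → ℕ → (ℕ → Bool) → ℕ) → ℕ → (ℕ → Bool) → ℕ → ℕ → ℕ
  leadingRun count v φ e f = D (suc v) ^ e * count v f (shift φ (sum (replicate e (suc v))))

  -- Partitions into j parts at most 1 + v, preceded by c further parts equal to 1 + v.
  prefixedPartitions : ℕ → ℕ → ℕ → (ℕ → Bool) → ℕ
  prefixedPartitions v c j φ =
    sumTuples j (λ b → 𝟙 (headAtMost (suc v) b ∧ nonIncreasing b) *
      (𝟙 (φ (sum (replicate c (suc v) ++ b))) * prodTerm D (c + j) 0 (runs (replicate c (suc v) ++ b))))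

  -- The next part either equals 1 + v, lengthening the prefix, or is at most v and closes it.
  module PrefixedHead (v c j : ℕ) (φ : ℕ → Bool) where
    u : ℕ
    u = suc v

    κ : ℕ
    κ = (c + suc j) C c

    W : List ℕ → ℕ
    W ys = 𝟙 (φ (sum (replicate c u ++ ys))) * prodTerm D (c + suc j) 0 (runs (replicate c u ++ ys))

    X : ℕ → ℕ
    X a = sumTuples j (λ b → 𝟙 (nonIncreasing (a ∷ b)) * W (a ∷ b))

    split : prefixedPartitions v c (suc j) φ
              ≡ sumOver (oneTo M) (λ a → 𝟙 (a ≡ᵇ u) * X a) + sumOver (oneTo M) (λ a → 𝟙 (a ≤ᵇ v) * X a)
    split = begin
      prefixedPartitions v c (suc j) φ
        ≡⟨ sumTuples-suc j (λ b → 𝟙 (headAtMost u b ∧ nonIncreasing b) * W b) ⟩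
      sumOver (oneTo M) (λ a → sumTuples j (λ b → 𝟙 ((a ≤ᵇ u) ∧ nonIncreasing (a ∷ b)) * W (a ∷ b)))
        ≡⟨ sumOver-cong (oneTo M) headWeight ⟩
      sumOver (oneTo M) (λ a → 𝟙 (a ≡ᵇ u) * X a + 𝟙 (a ≤ᵇ v) * X a)
        ≡⟨ sumOver-+ (oneTo M) _ _ ⟩
      sumOver (oneTo M) (λ a → 𝟙 (a ≡ᵇ u) * X a) + sumOver (oneTo M) (λ a → 𝟙 (a ≤ᵇ v) * X a) ∎
      where
      open ≡-Reasoning
      headWeight : ∀ a → sumTuples j (λ b → 𝟙 ((a ≤ᵇ u) ∧ nonIncreasing (a ∷ b)) * W (a ∷ b))
                           ≡ 𝟙 (a ≡ᵇ u) * X a + 𝟙 (a ≤ᵇ v) * X a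
      headWeight a = begin
        sumTuples j (λ b → 𝟙 ((a ≤ᵇ u) ∧ nonIncreasing (a ∷ b)) * W (a ∷ b))
          ≡⟨ sumTuples-cong j (λ b → trans (cong (_* W (a ∷ b)) (𝟙-∧ (a ≤ᵇ u) (nonIncreasing (a ∷ b))))
                                           (*-assoc (𝟙 (a ≤ᵇ u)) _ _)) ⟩
        sumTuples j (λ b → 𝟙 (a ≤ᵇ u) * (𝟙 (nonIncreasing (a ∷ b)) * W (a ∷ b)))
          ≡⟨ sumTuples-*ˡ j (𝟙 (a ≤ᵇ u)) (λ b → 𝟙 (nonIncreasing (a ∷ b)) * W (a ∷ b)) ⟩
        𝟙 (a ≤ᵇ u) * X a
          ≡⟨ cong (_* X a) (𝟙-≤ᵇ-suc a v) ⟩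
        (𝟙 (a ≡ᵇ u) + 𝟙 (a ≤ᵇ v)) * X a
          ≡⟨ *-distribʳ-+ (X a) (𝟙 (a ≡ᵇ u)) _ ⟩
        𝟙 (a ≡ᵇ u) * X a + 𝟙 (a ≤ᵇ v) * X a ∎

    extend : X u ≡ prefixedPartitions v (suc c) j φ
    extend = sumTuples-cong j (λ b → cong₂ _*_ (cong 𝟙 (nonIncreasing-∷ u b)) (begin
      W (u ∷ b)
        ≡⟨ cong (λ L → 𝟙 (φ (sum L)) * prodTerm D (c + suc j) 0 (runs L)) (replicate-++-∷ c u b) ⟩
      𝟙 (φ (sum (u ∷ replicate c u ++ b))) * prodTerm D (c + suc j) 0 (runs (u ∷ replicate c u ++ b))
        ≡⟨ cong (λ z → 𝟙 (φ (sum (u ∷ replicate c u ++ b))) * prodTerm D z 0 (runs (u ∷ replicate c u ++ b))) (+-suc c j) ⟩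
      𝟙 (φ (sum (u ∷ replicate c u ++ b))) * prodTerm D (suc c + j) 0 (runs (u ∷ replicate c u ++ b)) ∎))
      where open ≡-Reasoning

    ψ : ℕ → Bool
    ψ = shift φ (sum (replicate c u))

    V : List ℕ → ℕ
    V ys = 𝟙 (ψ (sum ys)) * prodTerm D (suc j) 0 (runs ys)

    X-below : ∀ a → a ≢ u → X a ≡ κ * (D u ^ c * sumTuples j (λ b → 𝟙 (nonIncreasing (a ∷ b)) * V (a ∷ b)))
    X-below a a≢u = begin
      X a
        ≡⟨ sumTuples-cong j (λ b → cong (𝟙 (nonIncreasing (a ∷ b)) *_) (cong₂ _*_
             (cong (𝟙 ∘ φ) (sum-++ (replicate c u) (a ∷ b)))
             (prodTerm-replicate-++ D u c (suc j) (a ∷ b) (insRun-firstRunNot a u (runs b) a≢u)))) ⟩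
      sumTuples j (λ b → 𝟙 (nonIncreasing (a ∷ b)) * (𝟙 (ψ (sum (a ∷ b))) * (κ * (D u ^ c * Π (a ∷ b)))))
        ≡⟨ sumTuples-cong j (λ b → rearrange (𝟙 (nonIncreasing (a ∷ b))) (𝟙 (ψ (sum (a ∷ b)))) κ (D u ^ c) (Π (a ∷ b))) ⟩
      sumTuples j (λ b → κ * (D u ^ c * (𝟙 (nonIncreasing (a ∷ b)) * V (a ∷ b))))
        ≡⟨ sumTuples-*ˡ j κ (λ b → D u ^ c * (𝟙 (nonIncreasing (a ∷ b)) * V (a ∷ b))) ⟩
      κ * sumTuples j (λ b → D u ^ c * (𝟙 (nonIncreasing (a ∷ b)) * V (a ∷ b)))
        ≡⟨ cong (κ *_) (sumTuples-*ˡ j (D u ^ c) (λ b → 𝟙 (nonIncreasing (a ∷ b)) * V (a ∷ b))) ⟩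
      κ * (D u ^ c * sumTuples j (λ b → 𝟙 (nonIncreasing (a ∷ b)) * V (a ∷ b))) ∎
      where
      open ≡-Reasoning
      Π : List ℕ → ℕ
      Π ys = prodTerm D (suc j) 0 (runs ys)
      rearrange : ∀ x y k d z → x * (y * (k * (d * z))) ≡ k * (d * (x * (y * z)))
      rearrange = solve-∀

    close : sumOver (oneTo M) (λ a → 𝟙 (a ≤ᵇ v) * X a) ≡ binomialTerm (leadingRun partitions v φ) c (suc j)
    close = begin
      sumOver (oneTo M) (λ a → 𝟙 (a ≤ᵇ v) * X a)
        ≡⟨ sumOver-cong (oneTo M) below ⟩
      sumOver (oneTo M) (λ a → κ * (D u ^ c * Y a))
        ≡⟨ sumOver-*ˡ (oneTo M) κ _ ⟩
      κ * sumOver (oneTo M) (λ a → D u ^ c * Y a)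
        ≡⟨ cong (κ *_) (sumOver-*ˡ (oneTo M) (D u ^ c) _) ⟩
      κ * (D u ^ c * sumOver (oneTo M) Y)
        ≡⟨ cong (λ z → κ * (D u ^ c * z)) (sym (sumTuples-suc j (λ ys → 𝟙 (headAtMost v ys ∧ nonIncreasing ys) * V ys))) ⟩
      binomialTerm (leadingRun partitions v φ) c (suc j) ∎
      where
      open ≡-Reasoning
      Y : ℕ → ℕ
      Y a = sumTuples j (λ b → 𝟙 ((a ≤ᵇ v) ∧ nonIncreasing (a ∷ b)) * V (a ∷ b))
      pullOut : ∀ a → Y a ≡ 𝟙 (a ≤ᵇ v) * sumTuples j (λ b → 𝟙 (nonIncreasing (a ∷ b)) * V (a ∷ b))
      pullOut a =
        trans (sumTuples-cong j (λ b → trans (cong (_* V (a ∷ b)) (𝟙-∧ (a ≤ᵇ v) (nonIncreasing (a ∷ b))))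
                                             (*-assoc (𝟙 (a ≤ᵇ v)) _ _)))
              (sumTuples-*ˡ j (𝟙 (a ≤ᵇ v)) (λ b → 𝟙 (nonIncreasing (a ∷ b)) * V (a ∷ b)))
      below : ∀ a → 𝟙 (a ≤ᵇ v) * X a ≡ κ * (D u ^ c * Y a)
      below a with a ≤ᵇ v in a≤v | pullOut a
      ... | false | Y≡0 = sym (trans (cong (λ z → κ * (D u ^ c * z)) Y≡0) (trans (cong (κ *_) (*-zeroʳ (D u ^ c))) (*-zeroʳ κ)))
      ... | true  | Y≡  =
        trans (+-identityʳ (X a)) (trans (X-below a a≢u) (cong (λ z → κ * (D u ^ c * z)) (trans (sym (+-identityʳ _)) (sym Y≡))))
        where
        a≢u : a ≢ u
        a≢u refl = <-irrefl refl (≤ᵇ⇒≤ (suc v) v (Equivalence.from T-≡ a≤v))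

  prefixedPartitions-suc : ∀ v → suc v ≤ M → ∀ c j φ →
    prefixedPartitions v c (suc j) φ ≡ prefixedPartitions v (suc c) j φ + binomialTerm (leadingRun partitions v φ) c (suc j)
  prefixedPartitions-suc v v<M c j φ =
    trans split (cong₂ _+_ (trans (sumOver-oneTo-select M u X (s≤s z≤n) v<M) extend) close)
    where open PrefixedHead v c j φ

  prefixedPartitions-zero : ∀ v c φ → prefixedPartitions v c 0 φ ≡ binomialTerm (leadingRun partitions v φ) c 0
  prefixedPartitions-zero v c φ =
    trans (cong₂ (λ s p → 1 * (𝟙 (φ s) * p) + 0) (sum-++ (replicate c (suc v)) []) (prodTerm-replicate-++ D (suc v) c 0 [] tt))
          (rearrange (𝟙 (φ (sum (replicate c (suc v)) + 0))) ((c + 0) C c) (D (suc v) ^ c))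
    where
    rearrange : ∀ x κ d → 1 * (x * (κ * (d * 1))) + 0 ≡ κ * (d * (1 * (x * 1) + 0))
    rearrange = solve-∀

  prefixedPartitions≡antidiagonal : ∀ v → suc v ≤ M → ∀ c j φ →
    prefixedPartitions v c j φ ≡ antidiagonal (λ e f → binomialTerm (leadingRun partitions v φ) (c + e) f) j
  prefixedPartitions≡antidiagonal v v<M c zero    φ =
    trans (prefixedPartitions-zero v c φ) (cong (λ e → binomialTerm (leadingRun partitions v φ) e 0) (sym (+-identityʳ c)))
  prefixedPartitions≡antidiagonal v v<M c (suc j) φ = begin
    prefixedPartitions v c (suc j) φ
      ≡⟨ prefixedPartitions-suc v v<M c j φ ⟩
    prefixedPartitions v (suc c) j φ + h c (suc j)
      ≡⟨ +-comm _ (h c (suc j)) ⟩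
    h c (suc j) + prefixedPartitions v (suc c) j φ
      ≡⟨ cong₂ _+_ (cong (λ e → h e (suc j)) (sym (+-identityʳ c)))
                   (trans (prefixedPartitions≡antidiagonal v v<M (suc c) j φ)
                          (antidiagonal-cong j (λ e f → cong (λ e′ → h e′ f) (sym (+-suc c e))))) ⟩
    h (c + 0) (suc j) + antidiagonal (λ e f → h (c + suc e) f) j ∎
    where
    open ≡-Reasoning
    h : ℕ → ℕ → ℕ
    h = binomialTerm (leadingRun partitions v φ)

  partitions-suc : ∀ v → suc v ≤ M → ∀ j φ → partitions (suc v) j φ ≡ binomialSum j (leadingRun partitions v φ)
  partitions-suc v v<M j φ = prefixedPartitions≡antidiagonal v v<M 0 j φ

  binomialSum-longerRun : ∀ v j φ →
    binomialSum j (λ e f → leadingRun compositions v φ (suc e) f)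
      ≡ D (suc v) * binomialSum j (leadingRun compositions v (shift φ (suc v)))
  binomialSum-longerRun v j φ =
    trans (antidiagonal-cong j (λ e f →
            trans (cong (λ z → ((e + f) C e) * ((D u * D u ^ e) * z))
                        (compositions-cong v f (λ t → cong φ (+-assoc u (sum (replicate e u)) t))))
                  (rearrange ((e + f) C e) (D u) (D u ^ e) _)))
          (antidiagonal-*ˡ j (D u) (binomialTerm (leadingRun compositions v (shift φ u))))
    where
    u : ℕ
    u = suc v
    rearrange : ∀ κ d p z → κ * ((d * p) * z) ≡ d * (κ * (p * z))
    rearrange = solve-∀

  binomialSum-longerTail : ∀ v j φ →
    binomialSum j (λ e f → leadingRun compositions v φ e (suc f))
      ≡ sumOver (oneTo v) (λ s → D s * binomialSum j (leadingRun compositions v (shift φ s)))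
  binomialSum-longerTail v j φ = sym (begin
    sumOver (oneTo v) (λ s → D s * binomialSum j (lr (shift φ s)))
      ≡⟨ sumOver-cong (oneTo v) (λ s → sym (antidiagonal-*ˡ j (D s) (binomialTerm (lr (shift φ s))))) ⟩
    sumOver (oneTo v) (λ s → antidiagonal (λ e f → D s * binomialTerm (lr (shift φ s)) e f) j)
      ≡⟨ antidiagonal-sumOver (oneTo v) j (λ s e f → D s * binomialTerm (lr (shift φ s)) e f) ⟨
    antidiagonal (λ e f → sumOver (oneTo v) (λ s → D s * binomialTerm (lr (shift φ s)) e f)) j
      ≡⟨ antidiagonal-cong j lengthen ⟩
    binomialSum j (λ e f → lr φ e (suc f)) ∎)
    where
    open ≡-Reasoning
    lr : (ℕ → Bool) → ℕ → ℕ → ℕ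
    lr = leadingRun compositions v
    rearrange : ∀ d κ p z → d * (κ * (p * z)) ≡ κ * (p * (d * z))
    rearrange = solve-∀
    lengthen : ∀ e f → sumOver (oneTo v) (λ s → D s * binomialTerm (lr (shift φ s)) e f) ≡ ((e + f) C e) * lr φ e (suc f)
    lengthen e f =
      trans (sumOver-cong (oneTo v) (λ s →
               trans (rearrange (D s) ((e + f) C e) (D (suc v) ^ e) _)
                     (cong (λ z → ((e + f) C e) * (D (suc v) ^ e * (D s * z)))
                           (compositions-cong v f (λ t → cong φ (+-exchange s (sum (replicate e (suc v))) t))))))
            (trans (sumOver-*ˡ (oneTo v) ((e + f) C e) _) (cong (((e + f) C e) *_) (sumOver-*ˡ (oneTo v) (D (suc v) ^ e) _)))

  -- Sorting by the number e of parts equal to the largest value 1 + v.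
  compositions-suc : ∀ v j φ → compositions (suc v) j φ ≡ binomialSum j (leadingRun compositions v φ)
  compositions-suc v zero    φ = sym (trans (*-identityˡ _) (*-identityˡ _))
  compositions-suc v (suc j) φ = begin
    compositions (suc v) (suc j) φ
      ≡⟨ sumOver-oneTo-suc v (λ s → D s * compositions (suc v) j (shift φ s)) ⟩
    sumOver (oneTo v) (λ s → D s * compositions (suc v) j (shift φ s)) + D u * compositions (suc v) j (shift φ u)
      ≡⟨ cong₂ _+_ (sumOver-cong (oneTo v) (λ s → cong (D s *_) (compositions-suc v j (shift φ s))))
                   (cong (D u *_) (compositions-suc v j (shift φ u))) ⟩
    sumOver (oneTo v) (λ s → D s * binomialSum j (lr (shift φ s))) + D u * binomialSum j (lr (shift φ u))
      ≡⟨ +-comm (sumOver (oneTo v) (λ s → D s * binomialSum j (lr (shift φ s)))) _ ⟩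
    D u * binomialSum j (lr (shift φ u)) + sumOver (oneTo v) (λ s → D s * binomialSum j (lr (shift φ s)))
      ≡⟨ cong₂ _+_ (binomialSum-longerRun v j φ) (binomialSum-longerTail v j φ) ⟨
    binomialSum j (λ e f → lr φ (suc e) f) + binomialSum j (λ e f → lr φ e (suc f))
      ≡⟨ binomialSum-suc j (lr φ) ⟨
    binomialSum (suc j) (lr φ) ∎
    where
    open ≡-Reasoning
    u : ℕ
    u = suc v
    lr : (ℕ → Bool) → ℕ → ℕ → ℕ
    lr = leadingRun compositions v

  partitions≡compositions : ∀ v → v ≤ M → ∀ j φ → partitions v j φ ≡ compositions v j φ
  partitions≡compositions zero    _   zero    φ = trans (+-identityʳ _) (trans (*-identityˡ _) (*-identityʳ _))
  partitions≡compositions zero    _   (suc j) φ =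
    trans (sumTuples-suc j (λ b → 𝟙 (headAtMost 0 b ∧ nonIncreasing b) * (𝟙 (φ (sum b)) * prodTerm D (suc j) 0 (runs b))))
          (sumOver-oneTo-zero M _ (λ a → sumTuples-zero j))
  partitions≡compositions (suc v) v<M j       φ =
    trans (partitions-suc v v<M j φ)
          (trans (binomialSum-cong j (λ e f → cong (D (suc v) ^ e *_) (partitions≡compositions v (≤-trans (n≤1+n v) v<M) f _)))
                 (sym (compositions-suc v j φ)))

-- The weight distribution

module WeightDistribution (n q k : ℕ) (F : FiniteField q) (w : Fin q → ℕ) (isWeight : IsWeight F w)
                          (_≼_ : Rel (Fin n) 0ℓ) (isDecPartialOrder : IsDecPartialOrder _≡_ _≼_) where

  open FiniteField F
  open IsWeight isWeight
  open IsDecPartialOrder isDecPartialOrder using (antisym) renaming (_≤?_ to _≼?_; refl to ≼-refl; trans to ≼-trans)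
  open Setting n q k F w _≼_ _≼?_
  open Partitions Dcard Mw

  Block : Set
  Block = Fin k → Fin q

  isZero : Block → Bool
  isZero u = allᶠ (λ t → ⌊ u t ≟ᶠ 0F ⌋)

  isZeroVec≡isZero : ∀ u → isZeroVec u ≡ isZero u
  isZeroVec≡isZero u = and-map-tabulate id (λ t → ⌊ u t ≟ᶠ 0F ⌋)

  wt≡maxᶠ : ∀ u → wt u ≡ maxᶠ (w ∘ u)
  wt≡maxᶠ u = foldr-⊔-tabulate id (w ∘ u)

  wt-zero : ∀ u → isZero u ≡ true → wt u ≡ 0
  wt-zero u u≡0 = trans (wt≡maxᶠ u) (maxᶠ-zero (w ∘ u) (λ t →
    trans (cong w (⌊⌋≡true⁻ (u t ≟ᶠ 0F) (allᶠ⇒∀ _ u≡0 t))) 0⇒zero))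

  wt-pos : ∀ u → isZero u ≡ false → 1 ≤ wt u
  wt-pos u u≢0 with allᶠ-false⇒∃ _ u≢0
  ... | t , ut≢0 = ≤-trans 1≤w (subst (w (u t) ≤_) (sym (wt≡maxᶠ u)) (f≤maxᶠ (w ∘ u) t))
    where
    1≤w : 1 ≤ w (u t)
    1≤w with w (u t) in wut
    ... | zero  with () ← trans (sym (⌊⌋≡true⁺ (u t ≟ᶠ 0F) (zero⇒0 (u t) wut))) ut≢0
    ... | suc _ = s≤s z≤n

  wt≤Mw : ∀ u → wt u ≤ Mw
  wt≤Mw u = subst₂ _≤_ (sym (wt≡maxᶠ u)) (sym (foldr-⊔-tabulate id w)) (maxᶠ-lub (w ∘ u) _ (λ t → f≤maxᶠ w (u t)))

  sumOver-vecs-const : ∀ c → sumOver (vecs k) (λ _ → c) ≡ q ^ k * c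
  sumOver-vecs-const c = trans (sumOver-allFuns-const (allFin q) k c) (cong (λ z → z ^ k * c) (length-tabulate id))

  sumOver-vecs-isZero : ∀ c → sumOver (vecs k) (λ u → 𝟙 (isZero u) * c) ≡ c
  sumOver-vecs-isZero = sumOver-allFuns-≟ (allFin q) _≟ᶠ_ allFin-unique k (λ _ → 0F)

  sumOver-vecs-weight : ∀ G → sumOver (vecs k) (λ u → 𝟙 (not (isZero u)) * G (wt u))
                             ≡ sumOver (oneTo Mw) (λ s → Dcard s * G s)
  sumOver-vecs-weight G = sym (begin
    sumOver (oneTo Mw) (λ s → Dcard s * G s)
      ≡⟨ sumOver-cong (oneTo Mw) (λ s → trans (cong (_* G s) (countB≡sumOver-𝟙 (λ u → wt u ≡ᵇ s) (vecs k)))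
                                             (count s)) ⟩
    sumOver (oneTo Mw) (λ s → sumOver (vecs k) (λ u → 𝟙 (wt u ≡ᵇ s) * G s))
      ≡⟨ sumOver-comm (oneTo Mw) (vecs k) (λ s u → 𝟙 (wt u ≡ᵇ s) * G s) ⟩
    sumOver (vecs k) (λ u → sumOver (oneTo Mw) (λ s → 𝟙 (wt u ≡ᵇ s) * G s))
      ≡⟨ sumOver-cong (vecs k) (λ u → trans (sumOver-cong (oneTo Mw) (λ s → cong (λ b → 𝟙 b * G s) (≡ᵇ-comm (wt u) s)))
                                           (select u (isZero u) refl)) ⟩
    sumOver (vecs k) (λ u → 𝟙 (not (isZero u)) * G (wt u)) ∎)
    where
    open ≡-Reasoning
    count : ∀ s → sumOver (vecs k) (λ u → 𝟙 (wt u ≡ᵇ s)) * G s ≡ sumOver (vecs k) (λ u → 𝟙 (wt u ≡ᵇ s) * G s)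
    count s = trans (*-comm _ (G s)) (trans (sym (sumOver-*ˡ (vecs k) (G s) _)) (sumOver-cong (vecs k) (λ u → *-comm (G s) _)))
    select : ∀ u b → isZero u ≡ b → sumOver (oneTo Mw) (λ s → 𝟙 (s ≡ᵇ wt u) * G s) ≡ 𝟙 (not b) * G (wt u)
    select u true  u≡0 rewrite wt-zero u u≡0 = sumOver-oneTo-zero Mw _ (λ _ → refl)
    select u false u≢0 = trans (sumOver-oneTo-select Mw (wt u) G (wt-pos u u≢0) (wt≤Mw u)) (sym (+-identityʳ _))

  -- A block x_i must vanish when i ∉ S and must not vanish when i is maximal in S.
  admissible : Bool → Bool → Block → Bool
  admissible inS isMaximal u = (inS ∨ isZero u) ∧ (not isMaximal ∨ not (isZero u))

  fitsPattern : ∀ {m} (S mx : Fin m → Bool) → (Fin m → Block) → Bool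
  fitsPattern S mx x = allᶠ (λ i → admissible (S i) (mx i) (x i))

  maximalWeight : ∀ {m} (mx : Fin m → Bool) → (Fin m → Block) → ℕ
  maximalWeight mx x = sumᶠ (λ i → if mx i then wt (x i) else 0)

  -- A block outside S has one choice, a non-maximal one q^k, and a maximal one is nonzero and adds its weight.
  countWords-step : ∀ (inS isMaximal : Bool) → (isMaximal ≡ true → inS ≡ true) → ∀ c₁ c₂ (W : (ℕ → Bool) → ℕ) →
    (∀ φ → W φ ≡ q ^ (k * c₁) * compositions Mw c₂ φ) → ∀ φ →
    sumOver (vecs k) (λ u → 𝟙 (admissible inS isMaximal u) * W (shift φ (if isMaximal then wt u else 0)))
      ≡ q ^ (k * (𝟙 (inS ∧ not isMaximal) + c₁)) * compositions Mw (𝟙 isMaximal + c₂) φ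
  countWords-step false false _ c₁ c₂ W W≡ φ =
    trans (sumOver-cong (vecs k) (λ u → cong (λ b → 𝟙 b * W φ) (∧-identityʳ (isZero u))))
          (trans (sumOver-vecs-isZero (W φ)) (W≡ φ))
  countWords-step true false _ c₁ c₂ W W≡ φ = begin
    sumOver (vecs k) (λ u → 1 * W φ)             ≡⟨ sumOver-cong (vecs k) (λ u → *-identityˡ (W φ)) ⟩
    sumOver (vecs k) (λ u → W φ)                 ≡⟨ sumOver-vecs-const (W φ) ⟩
    q ^ k * W φ                                  ≡⟨ cong (q ^ k *_) (W≡ φ) ⟩
    q ^ k * (q ^ (k * c₁) * compositions Mw c₂ φ) ≡⟨ *-assoc (q ^ k) _ _ ⟨
    q ^ k * q ^ (k * c₁) * compositions Mw c₂ φ   ≡⟨ cong (_* compositions Mw c₂ φ) (^-distribˡ-+-* q k (k * c₁)) ⟨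
    q ^ (k + k * c₁) * compositions Mw c₂ φ       ≡⟨ cong (λ e → q ^ e * compositions Mw c₂ φ) (*-suc k c₁) ⟨
    q ^ (k * suc c₁) * compositions Mw c₂ φ       ∎
    where open ≡-Reasoning
  countWords-step true true _ c₁ c₂ W W≡ φ = begin
    sumOver (vecs k) (λ u → 𝟙 (not (isZero u)) * W (shift φ (wt u)))
      ≡⟨ sumOver-cong (vecs k) (λ u → trans (cong (𝟙 (not (isZero u)) *_) (W≡ (shift φ (wt u))))
                                          (x*[y*z]≡y*[x*z] (𝟙 (not (isZero u))) (q ^ (k * c₁)) _)) ⟩
    sumOver (vecs k) (λ u → q ^ (k * c₁) * (𝟙 (not (isZero u)) * compositions Mw c₂ (shift φ (wt u))))
      ≡⟨ sumOver-*ˡ (vecs k) (q ^ (k * c₁)) _ ⟩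
    q ^ (k * c₁) * sumOver (vecs k) (λ u → 𝟙 (not (isZero u)) * compositions Mw c₂ (shift φ (wt u)))
      ≡⟨ cong (q ^ (k * c₁) *_) (sumOver-vecs-weight (λ s → compositions Mw c₂ (shift φ s))) ⟩
    q ^ (k * c₁) * compositions Mw (suc c₂) φ ∎
    where
    open ≡-Reasoning
    x*[y*z]≡y*[x*z] : ∀ x y z → x * (y * z) ≡ y * (x * z)
    x*[y*z]≡y*[x*z] = solve-∀
  countWords-step false true max⇒inS c₁ c₂ W W≡ φ with () ← max⇒inS refl

  countWords : ∀ m (S mx : Fin m → Bool) → (∀ i → mx i ≡ true → S i ≡ true) → ∀ φ →
    countB (λ x → fitsPattern S mx x ∧ φ (maximalWeight mx x)) (allFuns (vecs k) m)
      ≡ q ^ (k * countᶠ (λ i → S i ∧ not (mx i))) * compositions Mw (countᶠ mx) φ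
  countWords zero    S mx mx⊆S φ rewrite *-zeroʳ k = refl
  countWords (suc m) S mx mx⊆S φ =
    trans (countB≡sumOver-𝟙 _ (allFuns (vecs k) (suc m)))
   (trans (sumOver-concatMap (vecs k) _ _)
   (trans (sumOver-cong (vecs k) (λ u →
             trans (sumOver-map (allFuns (vecs k) m) _ _)
                   (trans (sym (countB≡sumOver-𝟙 (P u) (allFuns (vecs k) m)))
                          (countB-∧-const (allFuns (vecs k) m) (admissible (S fzero) (mx fzero) u)
                                          (fitsPattern (S ∘ fsuc) (mx ∘ fsuc)) (R u)))))
          (countWords-step (S fzero) (mx fzero) (mx⊆S fzero) _ _ W (countWords m (S ∘ fsuc) (mx ∘ fsuc) (mx⊆S ∘ fsuc)) φ)))
    where
    W : (ℕ → Bool) → ℕ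
    W ψ = countB (λ x → fitsPattern (S ∘ fsuc) (mx ∘ fsuc) x ∧ ψ (maximalWeight (mx ∘ fsuc) x)) (allFuns (vecs k) m)
    R : Block → (Fin m → Block) → Bool
    R u x = φ ((if mx fzero then wt u else 0) + maximalWeight (mx ∘ fsuc) x)
    P : Block → (Fin m → Block) → Bool
    P u x = (admissible (S fzero) (mx fzero) u ∧ fitsPattern (S ∘ fsuc) (mx ∘ fsuc) x) ∧ R u x

  ≺ᵇ⁺ : ∀ i j → i ≼ j → i ≢ j → (i ≺ᵇ j) ≡ true
  ≺ᵇ⁺ i j i≼j i≢j = cong₂ (λ a b → a ∧ not b) (⌊⌋≡true⁺ (i ≼? j) i≼j) (⌊⌋≡false⁺ (i ≟ᶠ j) i≢j)

  ≺ᵇ⁻ : ∀ i j → (i ≺ᵇ j) ≡ true → i ≼ j × i ≢ j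
  ≺ᵇ⁻ i j i≺j with ∧≡true⁻ {⌊ i ≼? j ⌋} i≺j
  ... | i≼j , i≢j = ⌊⌋≡true⁻ (i ≼? j) i≼j , ⌊⌋≡false⁻ (i ≟ᶠ j) (not≡true⁻ i≢j)

  ≺ᵇ-irrefl : ∀ i → (i ≺ᵇ i) ≡ false
  ≺ᵇ-irrefl i = trans (cong (λ b → ⌊ i ≼? i ⌋ ∧ not b) (⌊⌋≡true⁺ (i ≟ᶠ i) refl)) (∧-zeroʳ _)

  isMax≡ : ∀ S i → isMax S i ≡ S i ∧ not (anyᶠ (λ j → S j ∧ (i ≺ᵇ j)))
  isMax≡ S i = cong (λ b → S i ∧ not b) (or-map-tabulate id (λ j → S j ∧ (i ≺ᵇ j)))

  isMax-cong : ∀ A B → (∀ i → A i ≡ B i) → ∀ i → isMax A i ≡ isMax B i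
  isMax-cong A B A≗B i =
    trans (isMax≡ A i)
          (trans (cong₂ (λ a b → a ∧ not b) (A≗B i) (anyᶠ-cong (λ j → cong (_∧ (i ≺ᵇ j)) (A≗B j))))
                 (sym (isMax≡ B i)))

  isMax⇒∈ : ∀ S i → isMax S i ≡ true → S i ≡ true
  isMax⇒∈ S i = proj₁ ∘ ∧≡true⁻

  isMax⇒≼⇒≡ : ∀ S i → isMax S i ≡ true → ∀ j → S j ≡ true → i ≼ j → i ≡ j
  isMax⇒≼⇒≡ S i i-max j j∈S i≼j with i ≟ᶠ j
  ... | yes i≡j = i≡j
  ... | no  i≢j with () ← trans (sym (∃⇒anyᶠ (λ l → S l ∧ (i ≺ᵇ l)) j (∧≡true⁺ j∈S (≺ᵇ⁺ i j i≼j i≢j))))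
                                (not≡true⁻ (proj₂ (∧≡true⁻ {S i} (trans (sym (isMax≡ S i)) i-max))))

  ¬isMax⇒∃≺ : ∀ S i → isMax S i ≡ false → S i ≡ true → ∃ λ j → S j ≡ true × (i ≺ᵇ j) ≡ true
  ¬isMax⇒∃≺ S i i-not-max i∈S with anyᶠ (λ j → S j ∧ (i ≺ᵇ j)) in above
  ... | true  = let j , j-above = anyᶠ⇒∃ _ above in j , ∧≡true⁻ {S j} j-above
  ... | false with () ← trans (sym i-not-max) (trans (isMax≡ S i) (cong₂ (λ a b → a ∧ not b) i∈S above))

  -- Each step up to a strictly larger element of S decreases the number of elements of S above it.
  ∃maximal≽ : ∀ S i → S i ≡ true → ∃ λ m → isMax S m ≡ true × i ≼ m
  ∃maximal≽ S i i∈S = climb (suc n) i (s≤s (countᶠ≤ _)) i∈S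
    where
    above : Fin n → ℕ
    above i = countᶠ (λ l → S l ∧ (i ≺ᵇ l))
    climb : ∀ fuel i → above i < fuel → S i ≡ true → ∃ λ m → isMax S m ≡ true × i ≼ m
    climb (suc fuel) i bound i∈S with isMax S i in i-max
    ... | true  = i , i-max , ≼-refl
    ... | false with ¬isMax⇒∃≺ S i i-max i∈S
    ... | j , j∈S , i≺j with ≺ᵇ⁻ i j i≺j
    ... | i≼j , i≢j with climb fuel j (≤-trans fewer (≤-pred bound)) j∈S
      where
      ≻j⇒≻i : ∀ l → (S l ∧ (j ≺ᵇ l)) ≡ true → (S l ∧ (i ≺ᵇ l)) ≡ true
      ≻j⇒≻i l l-above with ∧≡true⁻ {S l} l-above
      ... | l∈S , j≺l with ≺ᵇ⁻ j l j≺l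
      ... | j≼l , _ = ∧≡true⁺ l∈S (≺ᵇ⁺ i l (≼-trans i≼j j≼l) (λ { refl → i≢j (antisym i≼j j≼l) }))
      fewer : above j < above i
      fewer = countᶠ-strict _ _ ≻j⇒≻i j (∧≡true⁺ j∈S i≺j) (trans (cong (S j ∧_) (≺ᵇ-irrefl j)) (∧-zeroʳ (S j)))
    ... | m , m-max , j≼m = m , m-max , ≼-trans i≼j j≼m

  closedPair : Subset → Fin n → Fin n → Bool
  closedPair S a b = not (S a ∧ ⌊ b ≼? a ⌋) ∨ S b

  isIdeal⁻ : ∀ S → isIdeal S ≡ true → ∀ a b → S a ≡ true → b ≼ a → S b ≡ true
  isIdeal⁻ S S-ideal a b a∈S b≼a = closed (allᶠ⇒∀ (closedPair S a) closedAt-a b)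
    where
    closedAt-a : allᶠ (closedPair S a) ≡ true
    closedAt-a = trans (sym (and-map-tabulate id (closedPair S a)))
                       (allᶠ⇒∀ (λ a → allFin? (closedPair S a))
                               (trans (sym (and-map-tabulate id (λ a → allFin? (closedPair S a)))) S-ideal) a)
    closed : closedPair S a b ≡ true → S b ≡ true
    closed rewrite a∈S | ⌊⌋≡true⁺ (b ≼? a) b≼a = id

  isIdeal⁺ : ∀ S → (∀ a b → S a ≡ true → b ≼ a → S b ≡ true) → isIdeal S ≡ true
  isIdeal⁺ S closed =
    trans (and-map-tabulate id (λ a → allFin? (closedPair S a)))
          (∀⇒allᶠ _ (λ a → trans (and-map-tabulate id (closedPair S a)) (∀⇒allᶠ (closedPair S a) (closed′ a))))
    where
    closed′ : ∀ a b → closedPair S a b ≡ true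
    closed′ a b with S a in a∈S | b ≼? a
    ... | false | _       = refl
    ... | true  | no _    = refl
    ... | true  | yes b≼a rewrite closed a b a∈S b≼a = refl

  supp≡ : ∀ x l → supp x l ≡ not (isZero (x l))
  supp≡ x l = cong not (isZeroVec≡isZero (x l))

  Ix⁻ : ∀ x j → Ix x j ≡ true → ∃ λ l → supp x l ≡ true × j ≼ l
  Ix⁻ x j j∈Ix
    with anyᶠ⇒∃ (λ l → supp x l ∧ ⌊ j ≼? l ⌋) (trans (sym (or-map-tabulate id (λ l → supp x l ∧ ⌊ j ≼? l ⌋))) j∈Ix)
  ... | l , l-above with ∧≡true⁻ {supp x l} l-above
  ... | l∈supp , j≼l = l , l∈supp , ⌊⌋≡true⁻ (j ≼? l) j≼l

  Ix⁺ : ∀ x j l → supp x l ≡ true → j ≼ l → Ix x j ≡ true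
  Ix⁺ x j l l∈supp j≼l =
    trans (or-map-tabulate id (λ l → supp x l ∧ ⌊ j ≼? l ⌋))
          (∃⇒anyᶠ (λ l → supp x l ∧ ⌊ j ≼? l ⌋) l (∧≡true⁺ l∈supp (⌊⌋≡true⁺ (j ≼? l) j≼l)))

  sameSubset : Subset → Subset → Bool
  sameSubset A B = allᶠ (λ i → ⌊ A i ≟ᵇ B i ⌋)

  sameSubset⁻ : ∀ A B → sameSubset A B ≡ true → ∀ i → A i ≡ B i
  sameSubset⁻ A B A≡B i = ⌊⌋≡true⁻ (A i ≟ᵇ B i) (allᶠ⇒∀ _ A≡B i)

  sameSubset⁺ : ∀ A B → (∀ i → A i ≡ B i) → sameSubset A B ≡ true
  sameSubset⁺ A B A≗B = ∀⇒allᶠ _ (λ i → ⌊⌋≡true⁺ (A i ≟ᵇ B i) (A≗B i))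

  admissible⁺ : ∀ inS isMaximal u → (inS ≡ false → isZero u ≡ true) → (isMaximal ≡ true → isZero u ≡ false) →
                admissible inS isMaximal u ≡ true
  admissible⁺ inS isMaximal u = go inS isMaximal (isZero u)
    where
    go : ∀ a b z → (a ≡ false → z ≡ true) → (b ≡ true → z ≡ false) → (a ∨ z) ∧ (not b ∨ not z) ≡ true
    go true  true  false _ _ = refl
    go true  false z     _ _ = refl
    go false false true  _ _ = refl
    go false false false h _ with () ← h refl
    go false true  z     h h′ with () ← trans (sym (h refl)) (h′ refl)
    go true  true  true  _ h′ with () ← h′ refl

  admissible⁻ : ∀ inS isMaximal u → admissible inS isMaximal u ≡ true →
                (inS ≡ false → isZero u ≡ true) × (isMaximal ≡ true → isZero u ≡ false)
  admissible⁻ inS isMaximal u = go inS isMaximal (isZero u)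
    where
    go : ∀ a b z → (a ∨ z) ∧ (not b ∨ not z) ≡ true → (a ≡ false → z ≡ true) × (b ≡ true → z ≡ false)
    go true  true  false _ = (λ ()) , (λ _ → refl)
    go true  false z     _ = (λ ()) , (λ ())
    go false false true  _ = (λ _ → refl) , (λ ())

  Ix≡S⇒fitsPattern : ∀ S x → sameSubset S (Ix x) ≡ true → fitsPattern S (isMax S) x ≡ true
  Ix≡S⇒fitsPattern S x Ix≡S = ∀⇒allᶠ _ (λ i → admissible⁺ (S i) (isMax S i) (x i) (outside i) (maximal i))
    where
    Ix≗S : ∀ i → Ix x i ≡ S i
    Ix≗S i = sym (sameSubset⁻ S (Ix x) Ix≡S i)
    outside : ∀ i → S i ≡ false → isZero (x i) ≡ true
    outside i i∉S with isZero (x i) in xi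
    ... | true  = refl
    ... | false with () ← trans (sym (trans (sym (Ix≗S i)) (Ix⁺ x i i (trans (supp≡ x i) (cong not xi)) ≼-refl))) i∉S
    maximal : ∀ i → isMax S i ≡ true → isZero (x i) ≡ false
    maximal i i-max with Ix⁻ x i (trans (Ix≗S i) (isMax⇒∈ S i i-max))
    ... | l , l∈supp , i≼l with isMax⇒≼⇒≡ S i i-max l (trans (sym (Ix≗S l)) (Ix⁺ x l l l∈supp ≼-refl)) i≼l
    ... | refl = not≡true⁻ (trans (sym (supp≡ x i)) l∈supp)

  fitsPattern⇒Ix≡S : ∀ S x → isIdeal S ≡ true → fitsPattern S (isMax S) x ≡ true → sameSubset S (Ix x) ≡ true
  fitsPattern⇒Ix≡S S x S-ideal fits = sameSubset⁺ S (Ix x) (λ i → sym (Ix≗S i))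
    where
    admissibleAt : ∀ i → (S i ≡ false → isZero (x i) ≡ true) × (isMax S i ≡ true → isZero (x i) ≡ false)
    admissibleAt i = admissible⁻ _ _ _ (allᶠ⇒∀ _ fits i)
    Ix≗S : ∀ i → Ix x i ≡ S i
    Ix≗S i with Ix x i in i∈Ix | S i in i∈S
    ... | true  | true  = refl
    ... | false | false = refl
    ... | true  | false with Ix⁻ x i i∈Ix
    ...   | l , l∈supp , i≼l with S l in l∈S
    ...     | true  with () ← trans (sym (isIdeal⁻ S S-ideal l i l∈S i≼l)) i∈S
    ...     | false with () ← trans (sym (trans (supp≡ x l) (cong not (proj₁ (admissibleAt l) l∈S)))) l∈supp
    Ix≗S i | false | true with ∃maximal≽ S i i∈S
    ... | m , m-max , i≼m
      with () ← trans (sym (Ix⁺ x i m (trans (supp≡ x m) (cong not (proj₂ (admissibleAt m) m-max))) i≼m)) i∈Ix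

  Ix≡S⇒isIdeal : ∀ S x → sameSubset S (Ix x) ≡ true → isIdeal S ≡ true
  Ix≡S⇒isIdeal S x Ix≡S = isIdeal⁺ S (λ a b a∈S b≼a → trans (sym (Ix≗S b)) (down a b (trans (Ix≗S a) a∈S) b≼a))
    where
    Ix≗S : ∀ i → Ix x i ≡ S i
    Ix≗S i = sym (sameSubset⁻ S (Ix x) Ix≡S i)
    down : ∀ a b → Ix x a ≡ true → b ≼ a → Ix x b ≡ true
    down a b a∈Ix b≼a with Ix⁻ x a a∈Ix
    ... | l , l∈supp , a≼l = Ix⁺ x b l l∈supp (≼-trans b≼a a≼l)

  sameSubset-Ix≡fitsPattern : ∀ S x → isIdeal S ≡ true → sameSubset S (Ix x) ≡ fitsPattern S (isMax S) x
  sameSubset-Ix≡fitsPattern S x S-ideal with sameSubset S (Ix x) in Ix≡S | fitsPattern S (isMax S) x in fits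
  ... | true  | true  = refl
  ... | false | false = refl
  ... | true  | false with () ← trans (sym (Ix≡S⇒fitsPattern S x Ix≡S)) fits
  ... | false | true  with () ← trans (sym (fitsPattern⇒Ix≡S S x S-ideal fits)) Ix≡S

  Ix≡S⇒pwWeight : ∀ S x → sameSubset S (Ix x) ≡ true →
    pwWeight x ≡ maximalWeight (isMax S) x + countᶠ (λ i → S i ∧ not (isMax S i)) * Mw
  Ix≡S⇒pwWeight S x Ix≡S = cong₂ (λ a b → a + b * Mw)
    (trans (sumOver-tabulate id (λ i → if isMax (Ix x) i then wt (x i) else 0))
           (sumᶠ-cong (λ i → cong (λ b → if b then wt (x i) else 0) (max≗ i))))
    (trans (countB-tabulate id (λ i → Ix x i ∧ not (isMax (Ix x) i)))
           (countᶠ-cong (λ i → cong₂ (λ a b → a ∧ not b) (Ix≗S i) (max≗ i))))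
    where
    Ix≗S : ∀ i → Ix x i ≡ S i
    Ix≗S i = sym (sameSubset⁻ S (Ix x) Ix≡S i)
    max≗ : ∀ i → isMax (Ix x) i ≡ isMax S i
    max≗ = isMax-cong (Ix x) S Ix≗S

  maxCount : Subset → ℕ
  maxCount S = countB (isMax S) (allFin n)

  card≤n : ∀ S → card S ≤ n
  card≤n S = subst (_≤ n) (sym (countB-tabulate id S)) (countᶠ≤ S)

  maxCount≤card : ∀ S → maxCount S ≤ card S
  maxCount≤card S =
    subst₂ _≤_ (sym (countB-tabulate id (isMax S))) (sym (countB-tabulate id S)) (countᶠ-mono (isMax S) S (isMax⇒∈ S))

  maxCount-pos : ∀ S → 1 ≤ card S → 1 ≤ maxCount S
  maxCount-pos S 1≤card with countᶠ-pos⇒∃ S (subst (1 ≤_) (countB-tabulate id S) 1≤card)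
  ... | i , i∈S with ∃maximal≽ S i i∈S
  ... | m , m-max , _ = subst (1 ≤_) (sym (countB-tabulate id (isMax S))) (countᶠ-pos (isMax S) m m-max)

  nonMaximalCount : ∀ S → countᶠ (λ i → S i ∧ not (isMax S i)) ≡ card S ∸ maxCount S
  nonMaximalCount S =
    sym (trans (cong₂ _∸_ (trans (countB-tabulate id S) (countᶠ-split S (isMax S) (isMax⇒∈ S))) (countB-tabulate id (isMax S)))
               (m+n∸n≡m _ (countᶠ (isMax S))))

  weightIs : ℕ → ℕ → ℕ → Bool
  weightIs r m s = (s + m * Mw) ≡ᵇ r

  wordsWithIdeal : ℕ → Subset → ℕ
  wordsWithIdeal r S = countB (λ x → sameSubset S (Ix x) ∧ (pwWeight x ≡ᵇ r)) allWords

  allSubsets : List Subset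
  allSubsets = allFuns (true ∷ false ∷ []) n

  Acard≡sumOver-wordsWithIdeal : ∀ r → Acard r ≡ sumOver allSubsets (wordsWithIdeal r)
  Acard≡sumOver-wordsWithIdeal r = begin
    Acard r
      ≡⟨ countB≡sumOver-𝟙 _ allWords ⟩
    sumOver allWords (λ x → 𝟙 (pwWeight x ≡ᵇ r))
      ≡⟨ sumOver-cong allWords (λ x → sym (uniqueIdeal x)) ⟩
    sumOver allWords (λ x → sumOver allSubsets (λ S → 𝟙 (sameSubset S (Ix x) ∧ (pwWeight x ≡ᵇ r))))
      ≡⟨ sumOver-comm allWords allSubsets (λ x S → 𝟙 (sameSubset S (Ix x) ∧ (pwWeight x ≡ᵇ r))) ⟩
    sumOver allSubsets (λ S → sumOver allWords (λ x → 𝟙 (sameSubset S (Ix x) ∧ (pwWeight x ≡ᵇ r))))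
      ≡⟨ sumOver-cong allSubsets (λ S → sym (countB≡sumOver-𝟙 _ allWords)) ⟩
    sumOver allSubsets (wordsWithIdeal r) ∎
    where
    open ≡-Reasoning
    uniqueIdeal : ∀ x → sumOver allSubsets (λ S → 𝟙 (sameSubset S (Ix x) ∧ (pwWeight x ≡ᵇ r)))
                        ≡ 𝟙 (pwWeight x ≡ᵇ r)
    uniqueIdeal x = trans (sumOver-cong allSubsets (λ S → 𝟙-∧ (sameSubset S (Ix x)) _))
                          (sumOver-allFuns-≟ (true ∷ false ∷ []) _≟ᵇ_ bools-unique n (Ix x) (𝟙 (pwWeight x ≡ᵇ r)))

  wordsWithIdeal-ideal : ∀ r S → isIdeal S ≡ true →
    wordsWithIdeal r S ≡ q ^ (k * (card S ∸ maxCount S)) * compositions Mw (maxCount S) (weightIs r (card S ∸ maxCount S))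
  wordsWithIdeal-ideal r S S-ideal = begin
    wordsWithIdeal r S
      ≡⟨ countB-cong allWords sameCondition ⟩
    countB (λ x → fitsPattern S (isMax S) x ∧ weightIs r m (maximalWeight (isMax S) x)) allWords
      ≡⟨ countWords n S (isMax S) (isMax⇒∈ S) (weightIs r m) ⟩
    q ^ (k * countᶠ (λ i → S i ∧ not (isMax S i))) * compositions Mw (countᶠ (isMax S)) (weightIs r m)
      ≡⟨ cong₂ (λ a b → q ^ (k * a) * compositions Mw b (weightIs r m))
               (nonMaximalCount S) (sym (countB-tabulate id (isMax S))) ⟩
    q ^ (k * m) * compositions Mw (maxCount S) (weightIs r m) ∎
    where
    open ≡-Reasoning
    m : ℕ
    m = card S ∸ maxCount S
    sameCondition : ∀ x → (sameSubset S (Ix x) ∧ (pwWeight x ≡ᵇ r))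
                          ≡ (fitsPattern S (isMax S) x ∧ weightIs r m (maximalWeight (isMax S) x))
    sameCondition x with sameSubset S (Ix x) in Ix≡S
    ... | false = sym (cong (_∧ _) (trans (sym (sameSubset-Ix≡fitsPattern S x S-ideal)) Ix≡S))
    ... | true  = cong₂ _∧_ (sym (Ix≡S⇒fitsPattern S x Ix≡S))
                            (cong (_≡ᵇ r) (trans (Ix≡S⇒pwWeight S x Ix≡S)
                                                 (cong (λ c → maximalWeight (isMax S) x + c * Mw) (nonMaximalCount S))))

  wordsWithIdeal-nonIdeal : ∀ r S → isIdeal S ≡ false → wordsWithIdeal r S ≡ 0
  wordsWithIdeal-nonIdeal r S S-not-ideal = trans (countB-cong allWords noWord) (countB-false allWords)
    where
    noWord : ∀ x → (sameSubset S (Ix x) ∧ (pwWeight x ≡ᵇ r)) ≡ false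
    noWord x with sameSubset S (Ix x) in Ix≡S
    ... | false = refl
    ... | true with () ← trans (sym (Ix≡S⇒isIdeal S x Ix≡S)) S-not-ideal

  sumOver-prtParts : ∀ r m j → 1 ≤ j → j ≤ n ∸ m →
    sumOver (prtParts m r j) (λ b → prodTerm Dcard j 0 (runs b)) ≡ partitions Mw j (weightIs r m)
  sumOver-prtParts r m (suc j) _ j<n∸m = begin
    sumOver (prtParts m r (suc j)) Π
      ≡⟨ sumOver-filterᵇ (inPRT m r) (map tabulate (allFuns (oneTo Mw) (suc j))) Π ⟩
    sumOver (map tabulate (allFuns (oneTo Mw) (suc j))) (λ b → 𝟙 (inPRT m r b) * Π b)
      ≡⟨ sumOver-map (allFuns (oneTo Mw) (suc j)) tabulate (λ b → 𝟙 (inPRT m r b) * Π b) ⟩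
    sumTuples (suc j) (λ b → 𝟙 (inPRT m r b) * Π b)
      ≡⟨ sumOver-cong (allFuns (oneTo Mw) (suc j))
                      (λ f → cong (λ c → 𝟙 c * Π (tabulate f)) (lengthCondition (tabulate f) (length-tabulate f))) ⟩
    sumTuples (suc j) (λ b → 𝟙 (nonIncreasing b ∧ weightIs r m (sum b)) * Π b)
      ≡⟨ sumTuples-suc j (λ b → 𝟙 (nonIncreasing b ∧ weightIs r m (sum b)) * Π b) ⟩
    sumOver (oneTo Mw) (λ a → sumTuples j (λ b → 𝟙 (nonIncreasing (a ∷ b) ∧ weightIs r m (sum (a ∷ b))) * Π (a ∷ b)))
      ≡⟨ sumOver-oneTo-cong Mw (λ a a≤Mw → sumTuples-cong j (headBound a a≤Mw)) ⟩
    sumOver (oneTo Mw) (λ a → sumTuples j (λ b →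
      𝟙 ((a ≤ᵇ Mw) ∧ nonIncreasing (a ∷ b)) * (𝟙 (weightIs r m (sum (a ∷ b))) * Π (a ∷ b))))
      ≡⟨ sumTuples-suc j (λ b → 𝟙 (headAtMost Mw b ∧ nonIncreasing b) * (𝟙 (weightIs r m (sum b)) * Π b)) ⟨
    partitions Mw (suc j) (weightIs r m) ∎
    where
    open ≡-Reasoning
    Π : List ℕ → ℕ
    Π b = prodTerm Dcard (suc j) 0 (runs b)
    lengthCondition : ∀ b → length b ≡ suc j → inPRT m r b ≡ (nonIncreasing b ∧ weightIs r m (sum b))
    lengthCondition b len≡ rewrite len≡ | Equivalence.to T-≡ (≤⇒≤ᵇ j<n∸m) = cong (nonIncreasing b ∧_) (∧-identityʳ _)
    headBound : ∀ a → a ≤ Mw → ∀ b → 𝟙 (nonIncreasing (a ∷ b) ∧ weightIs r m (sum (a ∷ b))) * Π (a ∷ b)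
                                    ≡ 𝟙 ((a ≤ᵇ Mw) ∧ nonIncreasing (a ∷ b)) * (𝟙 (weightIs r m (sum (a ∷ b))) * Π (a ∷ b))
    headBound a a≤Mw b rewrite Equivalence.to T-≡ (≤⇒≤ᵇ a≤Mw) =
      trans (cong (_* Π (a ∷ b)) (𝟙-∧ (nonIncreasing (a ∷ b)) _)) (*-assoc (𝟙 (nonIncreasing (a ∷ b))) _ _)

  idealTerm : ℕ → ℕ → ℕ → ℕ
  idealTerm r i j = sumOver (prtParts (i ∸ j) r j) (λ b → q ^ (k * (i ∸ j)) * prodTerm Dcard j 0 (runs b))

  isIdealOfShape : ℕ → ℕ → Subset → Bool
  isIdealOfShape i j S = isIdeal S ∧ (card S ≡ᵇ i) ∧ (maxCount S ≡ᵇ j)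

  shapeSum : ℕ → Subset → ℕ
  shapeSum r S = sumOver (oneTo n) (λ i → sumOver (oneTo i) (λ j → 𝟙 (isIdealOfShape i j S) * idealTerm r i j))

  rhs≡sumOver-shapeSum : ∀ r → rhs r ≡ sumOver allSubsets (shapeSum r)
  rhs≡sumOver-shapeSum r = begin
    rhs r
      ≡⟨ sumOver-cong (oneTo n) (λ i → sumOver-cong (oneTo i) (λ j →
           sumOver-filterᵇ (isIdealOfShape i j) allSubsets (λ _ → idealTerm r i j))) ⟩
    sumOver (oneTo n) (λ i → sumOver (oneTo i) (λ j → sumOver allSubsets (λ S → 𝟙 (isIdealOfShape i j S) * idealTerm r i j)))
      ≡⟨ sumOver-cong (oneTo n) (λ i → sumOver-comm (oneTo i) allSubsets (λ j S → 𝟙 (isIdealOfShape i j S) * idealTerm r i j)) ⟩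
    sumOver (oneTo n) (λ i → sumOver allSubsets (λ S → sumOver (oneTo i) (λ j → 𝟙 (isIdealOfShape i j S) * idealTerm r i j)))
      ≡⟨ sumOver-comm (oneTo n) allSubsets (λ i S → sumOver (oneTo i) (λ j → 𝟙 (isIdealOfShape i j S) * idealTerm r i j)) ⟩
    sumOver allSubsets (shapeSum r) ∎
    where open ≡-Reasoning

  idealTerm≡wordsWithIdeal : ∀ r S → isIdeal S ≡ true → 1 ≤ card S → idealTerm r (card S) (maxCount S) ≡ wordsWithIdeal r S
  idealTerm≡wordsWithIdeal r S S-ideal 1≤card = begin
    idealTerm r (card S) (maxCount S)
      ≡⟨ sumOver-*ˡ (prtParts m r j) (q ^ (k * m)) (λ b → prodTerm Dcard j 0 (runs b)) ⟩
    q ^ (k * m) * sumOver (prtParts m r j) (λ b → prodTerm Dcard j 0 (runs b))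
      ≡⟨ cong (q ^ (k * m) *_) (sumOver-prtParts r m j (maxCount-pos S 1≤card) j≤n∸m) ⟩
    q ^ (k * m) * partitions Mw j (weightIs r m)
      ≡⟨ cong (q ^ (k * m) *_) (partitions≡compositions Mw ≤-refl j (weightIs r m)) ⟩
    q ^ (k * m) * compositions Mw j (weightIs r m)
      ≡⟨ wordsWithIdeal-ideal r S S-ideal ⟨
    wordsWithIdeal r S ∎
    where
    open ≡-Reasoning
    j m : ℕ
    j = maxCount S
    m = card S ∸ maxCount S
    j≤n∸m : j ≤ n ∸ m
    j≤n∸m = m+n≤o⇒m≤o∸n j (subst (_≤ n) (sym (m+[n∸m]≡n (maxCount≤card S))) (card≤n S))

  -- The zero word is the only word with empty ideal, and its weight 0 is excluded by 1 ≤ r.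
  wordsWithIdeal-empty : ∀ r → 1 ≤ r → ∀ S → isIdeal S ≡ true → card S ≡ 0 → wordsWithIdeal r S ≡ 0
  wordsWithIdeal-empty (suc r) _ S S-ideal card≡0
    rewrite wordsWithIdeal-ideal (suc r) S S-ideal | card≡0 | n≤0⇒n≡0 (subst (maxCount S ≤_) card≡0 (maxCount≤card S)) =
    *-zeroʳ (q ^ (k * 0))

  shapeSum≡wordsWithIdeal : ∀ r → 1 ≤ r → ∀ S → shapeSum r S ≡ wordsWithIdeal r S
  shapeSum≡wordsWithIdeal r 1≤r S with isIdeal S in isIdeal≡
  ... | false =
    trans (sumOver-zero (oneTo n) (λ i → sumOver-zero (oneTo i) (λ j → refl))) (sym (wordsWithIdeal-nonIdeal r S isIdeal≡))
  ... | true  =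
    trans (sumOver-cong (oneTo n) (λ i → trans (sumOver-cong (oneTo i) (λ j → separate i j))
                                               (sumOver-*ˡ (oneTo i) (𝟙 (i ≡ᵇ card S)) _)))
          (select (card S) refl)
    where
    separate : ∀ i j → 𝟙 ((card S ≡ᵇ i) ∧ (maxCount S ≡ᵇ j)) * idealTerm r i j
                       ≡ 𝟙 (i ≡ᵇ card S) * (𝟙 (j ≡ᵇ maxCount S) * idealTerm r i j)
    separate i j = trans (cong (_* idealTerm r i j) (𝟙-∧ (card S ≡ᵇ i) _))
                         (trans (*-assoc (𝟙 (card S ≡ᵇ i)) _ _)
                                (cong₂ (λ a b → 𝟙 a * (𝟙 b * idealTerm r i j))
                                       (≡ᵇ-comm (card S) i) (≡ᵇ-comm (maxCount S) j)))
    G : ℕ → ℕ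
    G i = sumOver (oneTo i) (λ j → 𝟙 (j ≡ᵇ maxCount S) * idealTerm r i j)
    select : ∀ c → card S ≡ c → sumOver (oneTo n) (λ i → 𝟙 (i ≡ᵇ card S) * G i) ≡ wordsWithIdeal r S
    select zero    card≡0 rewrite card≡0 =
      trans (sumOver-oneTo-zero n _ (λ _ → refl)) (sym (wordsWithIdeal-empty r 1≤r S isIdeal≡ card≡0))
    select (suc c) card≡1+c =
      trans (sumOver-oneTo-select n (card S) G 1≤card (card≤n S))
            (trans (sumOver-oneTo-select (card S) (maxCount S) (idealTerm r (card S))
                                         (maxCount-pos S 1≤card) (maxCount≤card S))
                   (idealTerm≡wordsWithIdeal r S isIdeal≡ 1≤card))
      where
      1≤card : 1 ≤ card S
      1≤card = subst (1 ≤_) (sym card≡1+c) (s≤s z≤n)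

proposition3p5 : (n q k : ℕ) (F : FiniteField q) (w : Fin q → ℕ) → IsWeight F w →
    (_≼_ : Rel (Fin n) 0ℓ) (P : IsDecPartialOrder _≡_ _≼_) → 1 ≤ k →
    (r : ℕ) → 1 ≤ r → r ≤ n * maxWeight w →
    Setting.Acard n q k F w _≼_ (IsDecPartialOrder._≤?_ P) r
      ≡ Setting.rhs n q k F w _≼_ (IsDecPartialOrder._≤?_ P) r
proposition3p5 n q k F w isWeight _≼_ P _ r 1≤r _ = begin
  Acard r                                ≡⟨ Acard≡sumOver-wordsWithIdeal r ⟩
  sumOver allSubsets (wordsWithIdeal r)  ≡⟨ sumOver-cong allSubsets (shapeSum≡wordsWithIdeal r 1≤r) ⟨
  sumOver allSubsets (shapeSum r)        ≡⟨ rhs≡sumOver-shapeSum r ⟨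
  rhs r                                  ∎
  where
  open ≡-Reasoning
  open WeightDistribution n q k F w isWeight _≼_ P
  open Setting n q k F w _≼_ (IsDecPartialOrder._≤?_ P)
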